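{- Let $S\subset\mathbb{R}^2$ be a finite set of distinct points with $|S|$ odd. For a point $x\in S$, the following three conditions are equivalent: (i) every line through $x$ is good; (ii) every perfect line contains $x$; (iii) every line through $x$ is even-balanced about $x$. Alice wins if and only if there exists a point $x\in S$ satisfying these conditions, and in that case $a=x$ is a winning point for Alice.
   Context: The game: Alice chooses $a\in\mathbb{R}^2$; then Bob, knowing $a$, chooses $b\in\mathbb{R}^2$. With $\rho$ the Euclidean distance, $V_A=|\{y\in S:\rho(a,y)<\rho(b,y)\}|$ and $V_B=|\{y\in S:\rho(b,y)<\rho(a,y)\}|$. A point $a$ is a winning point for Alice if $V_A\ge V_B$ for every $b$; Alice wins if a winning point exists. A line $l$ in the plane is good if the two open half-planes bounded by $l$ contain the same number of points of $S$, and perfect if it is good and contains exactly one point of $S$. For a line $l$ through $x$, $l^+,l^-$ denote the two open half-lines into which $x$ divides $l$; $l$ is even-balanced about $x$ if $|l^+\cap S|=|l^-\cap S|$. -}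

module Defs where

open import Data.Nat using (ℕ; zero; suc; _≤_)
open import Data.Nat.Base using (_%_)
open import Data.Bool using (Bool; true; false; _∧_; not)
open import Data.Product using (_×_; _,_; Σ; ∃; ∃-syntax; proj₁; proj₂)
open import Data.List using (List; []; _∷_; length)
open import Data.List.Membership.Propositional using (_∈_)
open import Data.List.Relation.Unary.Unique.Propositional using (Unique)
open import Relation.Binary using (Tri; tri<; tri≈; tri>; Trichotomous)
open import Relation.Binary.PropositionalEquality using (_≡_; _≢_)
open import Relation.Nullary using (¬_)
open import Data.Sum using (_⊎_)
open import Algebra.Structures using (IsCommutativeRing)

-- The real numbers, given axiomatically as a complete ordered field
-- (every complete ordered field is isomorphic to ℝ).

record RealField : Set₁ where
  infixl 6 _+_ _-_
  infixl 7 _*_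
  infix 4 _<_
  field
    ℝ     : Set
    _+_   : ℝ → ℝ → ℝ
    _*_   : ℝ → ℝ → ℝ
    -_    : ℝ → ℝ
    0ℝ    : ℝ
    1ℝ    : ℝ
    _<_   : ℝ → ℝ → Set
    isCommutativeRing : IsCommutativeRing _≡_ _+_ _*_ -_ 0ℝ 1ℝ
    0≢1   : 0ℝ ≢ 1ℝ
    inverse : ∀ x → x ≢ 0ℝ → ∃[ y ] (x * y ≡ 1ℝ)
    <-irrefl : ∀ x → ¬ (x < x)
    <-trans  : ∀ {x y z} → x < y → y < z → x < z
    <-tri    : Trichotomous _≡_ _<_
    +-mono-< : ∀ {x y} z → x < y → x + z < y + z
    *-pos    : ∀ {x y} → 0ℝ < x → 0ℝ < y → 0ℝ < x * y
    complete : (P : ℝ → Set) → ∃[ x ] P x →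
               ∃[ u ] (∀ x → P x → (x < u ⊎ x ≡ u)) →
               ∃[ s ] ((∀ x → P x → (x < s ⊎ x ≡ s)) ×
                       (∀ u → (∀ x → P x → (x < u ⊎ x ≡ u)) → (s < u ⊎ s ≡ u)))

  _-_ : ℝ → ℝ → ℝ
  x - y = x + (- y)

  _<ᵇ_ : ℝ → ℝ → Bool
  x <ᵇ y with <-tri x y
  ... | tri< _ _ _ = true
  ... | tri≈ _ _ _ = false
  ... | tri> _ _ _ = false

  _≡ᵇ_ : ℝ → ℝ → Bool
  x ≡ᵇ y with <-tri x y
  ... | tri< _ _ _ = false
  ... | tri≈ _ _ _ = true
  ... | tri> _ _ _ = false

module Plane (R : RealField) where
  open RealField R

  Point : Set
  Point = ℝ × ℝ

  sq : ℝ → ℝ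
  sq t = t * t

  -- squared Euclidean distance; ρ(a,y) < ρ(b,y) iff dist²(a,y) < dist²(b,y)
  dist² : Point → Point → ℝ
  dist² (a₁ , a₂) (y₁ , y₂) = sq (a₁ - y₁) + sq (a₂ - y₂)

  count : (Point → Bool) → List Point → ℕ
  count p [] = 0
  count p (y ∷ ys) with p y
  ... | true  = suc (count p ys)
  ... | false = count p ys

  V-A : List Point → Point → Point → ℕ
  V-A S a b = count (λ y → dist² a y <ᵇ dist² b y) S

  V-B : List Point → Point → Point → ℕ
  V-B S a b = count (λ y → dist² b y <ᵇ dist² a y) S

  WinningPoint : List Point → Point → Set
  WinningPoint S a = ∀ (b : Point) → V-B S a b ≤ V-A S a b

  AliceWins : List Point → Set
  AliceWins S = ∃[ a ] WinningPoint S a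

  record Line : Set where
    constructor line
    field
      α β γ  : ℝ
      nondeg : ¬ (α ≡ 0ℝ × β ≡ 0ℝ)
  open Line public

  lval : Line → Point → ℝ
  lval l (y₁ , y₂) = α l * y₁ + β l * y₂

  OnLine : Line → Point → Set
  OnLine l y = lval l y ≡ γ l

  onLineᵇ : Line → Point → Bool
  onLineᵇ l y = lval l y ≡ᵇ γ l

  aboveᵇ belowᵇ : Line → Point → Bool
  aboveᵇ l y = γ l <ᵇ lval l y
  belowᵇ l y = lval l y <ᵇ γ l

  Good : List Point → Line → Set
  Good S l = count (aboveᵇ l) S ≡ count (belowᵇ l) S

  Perfect : List Point → Line → Set
  Perfect S l = Good S l × count (onLineᵇ l) S ≡ 1

  -- signed position of y along l (direction vector (-β, α)) relative to x
  along : Line → Point → Point → ℝ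
  along l (x₁ , x₂) (y₁ , y₂) = (- β l) * (y₁ - x₁) + α l * (y₂ - x₂)

  l⁺ᵇ l⁻ᵇ : Line → Point → Point → Bool
  l⁺ᵇ l x y = onLineᵇ l y ∧ (0ℝ <ᵇ along l x y)
  l⁻ᵇ l x y = onLineᵇ l y ∧ (along l x y <ᵇ 0ℝ)

  EvenBalanced : List Point → Line → Point → Set
  EvenBalanced S l x = count (l⁺ᵇ l x) S ≡ count (l⁻ᵇ l x) S

  Cond-i : List Point → Point → Set
  Cond-i S x = ∀ (l : Line) → OnLine l x → Good S l

  Cond-ii : List Point → Point → Set
  Cond-ii S x = ∀ (l : Line) → Perfect S l → OnLine l x

  Cond-iii : List Point → Point → Set
  Cond-iii S x = ∀ (l : Line) → OnLine l x → EvenBalanced S l x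

-- Condition (i) only needs checking in generic directions, those in which no line contains two
-- points of S: turning a line through c by a small angle ±ε makes its direction generic and moves
-- one of its two rays from c to each side, so comparing the two turns balances the rays, giving (iii).
-- Conversely, the rays of the line ℓ through c and another point lie on opposite sides of every other
-- line through c, so the points of ℓ contribute equally to both sides; induct on the points off ℓ.
-- (i) ⇒ (ii): a perfect line missing x and its parallel through x cannot both be good. (ii) ⇒ (i):
-- in a generic direction the line through the median point of S is perfect, so it passes through x.
-- In the game, every point Bob at b takes from Alice at c lies strictly on b's side of the line
-- through c perpendicular to b - c, so (i) makes c a winning point. Conversely, a rival just off c
-- in direction n takes every point strictly on n's side of the line through c, so a winning c has at
-- most half of S on either side of any line through it; in a direction generic for S and c, the
-- parity of |S| then forces c ∈ S and equal sides.
{-# OPTIONS --safe #-}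
module Submission where

open import Defs
open import Data.Nat using (ℕ)
open import Data.Nat.Base using (_%_)
open import Data.Product using (_×_; ∃-syntax)
open import Data.List using (List; length)
open import Data.List.Membership.Propositional using (_∈_)
open import Data.List.Relation.Unary.Unique.Propositional using (Unique)
open import Relation.Binary.PropositionalEquality using (_≡_)
open import Function.Bundles using (_⇔_)

open import Algebra.Bundles using (CommutativeRing; RawRing)
import Algebra.Solver.Ring
import Algebra.Solver.Ring.AlmostCommutativeRing as ACR
import Algebra.Solver.Ring.NaturalCoefficients.Default as NaturalCoefficients
open import Data.Bool using (Bool; true; false; _∧_; _∨_; not; T; T?)
open import Data.Bool.Properties using (∧-zeroʳ; ∧-conicalˡ; ∧-conicalʳ; T-≡; ¬-not; not-¬)
open import Data.Empty using (⊥; ⊥-elim)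
open import Data.List using ([]; _∷_; map; filterᵇ; cartesianProductWith)
open import Data.List.Membership.Propositional.Properties using (∈-map⁺; ∈-cartesianProductWith⁺)
import Data.List.Properties as Listₚ
open import Data.List.Relation.Unary.Any using (here; there)
import Data.List.Relation.Unary.All as All
open import Data.List.Relation.Unary.AllPairs using (_∷_)
open import Data.Maybe using (Maybe; just; nothing)
import Data.Nat as ℕ
open import Data.Nat using (zero; suc; z≤n; s≤s; _/_)
open import Data.Nat.DivMod using (m*n%n≡0; m≡m%n+[m/n]*n)
import Data.Nat.Properties as ℕ
open import Data.Nat.Tactic.RingSolver using (solve-∀)
open import Data.Product using (_,_; proj₁; proj₂)
open import Data.Product.Properties using (≡-dec)
open import Data.Sum using (_⊎_; inj₁; inj₂)
open import Function using (_∘_; _∘′_; id)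
open import Function.Bundles using (mk⇔; Equivalence)
open import Relation.Binary using (Tri; tri<; tri≈; tri>)
open import Relation.Binary.PropositionalEquality
  using (_≢_; refl; sym; trans; cong; cong₂; subst; subst₂; module ≡-Reasoning)
open import Relation.Nullary using (¬_; Dec; yes; no)

module IntegerCoefficientSolver {c ℓ} (R : CommutativeRing c ℓ) where

  private
    open CommutativeRing R renaming (refl to ≈-refl; sym to ≈-sym; trans to ≈-trans)
    open import Algebra.Properties.Semiring.Mult.TCOptimised semiring using (×-homo-+; ×1-homo-*) renaming (_×_ to _·_)
    open import Algebra.Properties.AbelianGroup +-abelianGroup using (⁻¹-anti-homo‿-; ⁻¹-∙-comm)
    open import Algebra.Properties.Group +-group using (∙-cancelʳ; ε⁻¹≈ε)
    open import Algebra.Properties.CommutativeSemigroup +-commutativeSemigroup using (interchange)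
    open import Relation.Binary.Reasoning.Setoid setoid
    module ℕ-Solver = NaturalCoefficients commutativeSemiring

    -‿+-cancelʳ : ∀ x y → (x - y) + y ≈ x
    -‿+-cancelʳ x y = begin
      (x - y) + y   ≈⟨ +-assoc x (- y) y ⟩
      x + (- y + y) ≈⟨ +-congˡ (-‿inverseˡ y) ⟩
      x + 0#        ≈⟨ +-identityʳ x ⟩
      x             ∎

    +⇒- : ∀ {x y z} → x + z ≈ y → x ≈ y - z
    +⇒- {x} {y} {z} eq = ∙-cancelʳ z x (y - z) (≈-trans eq (≈-sym (-‿+-cancelʳ y z)))

    -- Integers as formal differences (m , n) = m - n, kept normalised (one side 0) so that
    -- equal integers are syntactically equal, as the solver's final refl check requires.
    Diff : Set
    Diff = ℕ × ℕ

    normalise : Diff → Diff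
    normalise (m , n) = (m ℕ.∸ n , n ℕ.∸ m)

    ∸-+-sym : ∀ m n → (m ℕ.∸ n) ℕ.+ n ≡ (n ℕ.∸ m) ℕ.+ m
    ∸-+-sym zero    zero    = refl
    ∸-+-sym zero    (suc n) = sym (ℕ.+-identityʳ (suc n))
    ∸-+-sym (suc m) zero    = ℕ.+-identityʳ (suc m)
    ∸-+-sym (suc m) (suc n) =
      trans (ℕ.+-suc (m ℕ.∸ n) n) (trans (cong suc (∸-+-sym m n)) (sym (ℕ.+-suc (n ℕ.∸ m) m)))

    diffRing : RawRing _ _
    diffRing = record
      { Carrier = Diff
      ; _≈_ = _≡_
      ; _+_ = λ { (a , b) (c , d) → normalise (a ℕ.+ c , b ℕ.+ d) }
      ; _*_ = λ { (a , b) (c , d) → normalise (a ℕ.* c ℕ.+ b ℕ.* d , a ℕ.* d ℕ.+ b ℕ.* c) }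
      ; -_  = λ { (a , b) → (b , a) }
      ; 0#  = (0 , 0)
      ; 1#  = (1 , 0)
      }

    ι : ℕ → Carrier
    ι n = n · 1#

    ι-+ : ∀ m n → ι (m ℕ.+ n) ≈ ι m + ι n
    ι-+ m n = ×-homo-+ 1# m n

    -- Split so that the numerals 0 and 1 denote 0# and 1# definitionally.
    ⟦_⟧ : Diff → Carrier
    ⟦ m     , zero  ⟧ = ι m
    ⟦ zero  , suc n ⟧ = - ι (suc n)
    ⟦ suc m , suc n ⟧ = ι (suc m) - ι (suc n)

    ⟦⟧≈- : ∀ m n → ⟦ m , n ⟧ ≈ ι m - ι n
    ⟦⟧≈- m       zero    = ≈-sym (≈-trans (+-congˡ ε⁻¹≈ε) (+-identityʳ (ι m)))
    ⟦⟧≈- zero    (suc n) = ≈-sym (+-identityˡ _)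
    ⟦⟧≈- (suc m) (suc n) = ≈-refl

    ι-difference-cong : ∀ a b c d → a ℕ.+ d ≡ b ℕ.+ c → ι a - ι b ≈ ι c - ι d
    ι-difference-cong a b c d eq = ∙-cancelʳ (ι b + ι d) _ _ (begin
      (ι a - ι b) + (ι b + ι d) ≈⟨ ≈-sym (+-assoc _ (ι b) (ι d)) ⟩
      ((ι a - ι b) + ι b) + ι d ≈⟨ +-congʳ (-‿+-cancelʳ (ι a) (ι b)) ⟩
      ι a + ι d                 ≈⟨ ≈-sym (ι-+ a d) ⟩
      ι (a ℕ.+ d)               ≡⟨ cong ι eq ⟩
      ι (b ℕ.+ c)               ≈⟨ ι-+ b c ⟩
      ι b + ι c                 ≈⟨ +-congˡ (≈-sym (-‿+-cancelʳ (ι c) (ι d))) ⟩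
      ι b + ((ι c - ι d) + ι d) ≈⟨ solve 3 (λ b u d → b :+ (u :+ d) := u :+ (b :+ d)) ≈-refl (ι b) (ι c - ι d) (ι d) ⟩
      (ι c - ι d) + (ι b + ι d) ∎)
      where open ℕ-Solver using (solve; _:+_; _:=_)

    ⟦⟧-cong : ∀ a b c d → a ℕ.+ d ≡ b ℕ.+ c → ⟦ a , b ⟧ ≈ ⟦ c , d ⟧
    ⟦⟧-cong a b c d eq = ≈-trans (⟦⟧≈- a b) (≈-trans (ι-difference-cong a b c d eq) (≈-sym (⟦⟧≈- c d)))

    ⟦normalise⟧ : ∀ p → ⟦ normalise p ⟧ ≈ ι (proj₁ p) - ι (proj₂ p)
    ⟦normalise⟧ (m , n) =
      ≈-trans (⟦⟧≈- (m ℕ.∸ n) (n ℕ.∸ m)) (ι-difference-cong (m ℕ.∸ n) (n ℕ.∸ m) m n (∸-+-sym m n))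

    -‿+-interchange : ∀ a b c d → (a + c) - (b + d) ≈ (a - b) + (c - d)
    -‿+-interchange a b c d = ≈-trans (+-congˡ (≈-sym (⁻¹-∙-comm b d))) (interchange a c (- b) (- d))

    -‿*-expand : ∀ a b c d → (a * c + b * d) - (a * d + b * c) ≈ (a - b) * (c - d)
    -‿*-expand a b c d = ≈-sym (+⇒- (begin
      u * v + (a * d + b * c)             ≈⟨ +-congˡ (+-cong (*-congʳ (≈-sym u+b≈a)) (*-congˡ (≈-sym v+d≈c))) ⟩
      u * v + ((u + b) * d + b * (v + d)) ≈⟨ solve 4 (λ u v b d → u :* v :+ ((u :+ b) :* d :+ b :* (v :+ d))
                                                              := (u :+ b) :* (v :+ d) :+ b :* d) ≈-refl u v b d ⟩
      (u + b) * (v + d) + b * d           ≈⟨ +-congʳ (*-cong u+b≈a v+d≈c) ⟩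
      a * c + b * d                       ∎))
      where
      open ℕ-Solver using (solve; _:+_; _:*_; _:=_)
      u v : Carrier
      u = a - b
      v = c - d
      u+b≈a : u + b ≈ a
      u+b≈a = -‿+-cancelʳ a b
      v+d≈c : v + d ≈ c
      v+d≈c = -‿+-cancelʳ c d

    ι-+-* : ∀ a c b d → ι (a ℕ.* c ℕ.+ b ℕ.* d) ≈ ι a * ι c + ι b * ι d
    ι-+-* a c b d = ≈-trans (ι-+ (a ℕ.* c) (b ℕ.* d)) (+-cong (×1-homo-* a c) (×1-homo-* b d))

    morphism : diffRing ACR.-Raw-AlmostCommutative⟶ ACR.fromCommutativeRing R
    morphism = record
      { ⟦_⟧    = ⟦_⟧
      ; +-homo = λ { (a , b) (c , d) → begin
          ⟦ normalise (a ℕ.+ c , b ℕ.+ d) ⟧ ≈⟨ ⟦normalise⟧ (a ℕ.+ c , b ℕ.+ d) ⟩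
          ι (a ℕ.+ c) - ι (b ℕ.+ d)         ≈⟨ +-cong (ι-+ a c) (-‿cong (ι-+ b d)) ⟩
          (ι a + ι c) - (ι b + ι d)         ≈⟨ -‿+-interchange (ι a) (ι b) (ι c) (ι d) ⟩
          (ι a - ι b) + (ι c - ι d)         ≈⟨ +-cong (⟦⟧≈- a b) (⟦⟧≈- c d) ⟨
          ⟦ a , b ⟧ + ⟦ c , d ⟧             ∎ }
      ; *-homo = λ { (a , b) (c , d) → begin
          ⟦ normalise (a ℕ.* c ℕ.+ b ℕ.* d , a ℕ.* d ℕ.+ b ℕ.* c) ⟧
            ≈⟨ ⟦normalise⟧ (a ℕ.* c ℕ.+ b ℕ.* d , a ℕ.* d ℕ.+ b ℕ.* c) ⟩
          ι (a ℕ.* c ℕ.+ b ℕ.* d) - ι (a ℕ.* d ℕ.+ b ℕ.* c)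
            ≈⟨ +-cong (ι-+-* a c b d) (-‿cong (ι-+-* a d b c)) ⟩
          (ι a * ι c + ι b * ι d) - (ι a * ι d + ι b * ι c)
            ≈⟨ -‿*-expand (ι a) (ι b) (ι c) (ι d) ⟩
          (ι a - ι b) * (ι c - ι d)
            ≈⟨ *-cong (⟦⟧≈- a b) (⟦⟧≈- c d) ⟨
          ⟦ a , b ⟧ * ⟦ c , d ⟧ ∎ }
      ; -‿homo = λ { (a , b) → begin
          ⟦ b , a ⟧     ≈⟨ ⟦⟧≈- b a ⟩
          ι b - ι a     ≈⟨ ⁻¹-anti-homo‿- (ι a) (ι b) ⟨
          - (ι a - ι b) ≈⟨ -‿cong (⟦⟧≈- a b) ⟨
          - ⟦ a , b ⟧   ∎ }
      ; 0-homo = ≈-refl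
      ; 1-homo = ≈-refl
      }

    _≟_ : ∀ p q → Maybe (⟦ p ⟧ ≈ ⟦ q ⟧)
    (a , b) ≟ (c , d) with a ℕ.+ d ℕ.≟ b ℕ.+ c
    ... | yes eq = just (⟦⟧-cong a b c d eq)
    ... | no _   = nothing

  private
    module Solver = Algebra.Solver.Ring diffRing (ACR.fromCommutativeRing R) morphism _≟_

  open Solver public using (solve; _:=_; _:+_; _:*_; _:-_; :-_)

  numeral : ∀ {n} → ℕ → Solver.Polynomial n
  numeral k = Solver.con (k , 0)

+-cross-cancel : ∀ a b p m → a ℕ.+ p ≡ b ℕ.+ m → a ℕ.+ m ≡ b ℕ.+ p → p ≡ m
+-cross-cancel a b p m a+p≡b+m a+m≡b+p with ℕ.<-cmp p m
... | tri≈ _ p≡m _ = p≡m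
... | tri< p<m _ _ = ⊥-elim (ℕ.<-irrefl refl (ℕ.<-trans (ℕ.+-monoʳ-< a p<m)
                       (subst₂ ℕ._<_ (sym a+m≡b+p) (sym a+p≡b+m) (ℕ.+-monoʳ-< b p<m))))
... | tri> _ _ m<p = ⊥-elim (ℕ.<-irrefl refl (ℕ.<-trans (ℕ.+-monoʳ-< a m<p)
                       (subst₂ ℕ._<_ (sym a+p≡b+m) (sym a+m≡b+p) (ℕ.+-monoʳ-< b m<p))))

double-not-odd : ∀ m → (m ℕ.+ m) % 2 ≢ 1
double-not-odd m odd = ℕ.0≢1+n (trans (sym (m*n%n≡0 m 2)) (trans (cong (_% 2) (m*2≡m+m m)) odd))
  where
  m*2≡m+m : ∀ m → m ℕ.* 2 ≡ m ℕ.+ m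
  m*2≡m+m = solve-∀

balanced-by-parity : ∀ {P N z} → P ℕ.≤ N ℕ.+ z → N ℕ.≤ P ℕ.+ z → z ℕ.≤ 1 →
                     (P ℕ.+ (N ℕ.+ z)) % 2 ≡ 1 → z ≡ 1 × P ≡ N
balanced-by-parity {P} {N} {zero} P≤N+0 N≤P+0 _ odd =
  ⊥-elim (double-not-odd P (subst (λ k → (P ℕ.+ k) % 2 ≡ 1) N+0≡P odd))
  where
  N+0≡P : N ℕ.+ 0 ≡ P
  N+0≡P = trans (ℕ.+-identityʳ N)
                (ℕ.≤-antisym (subst (N ℕ.≤_) (ℕ.+-identityʳ P) N≤P+0) (subst (P ℕ.≤_) (ℕ.+-identityʳ N) P≤N+0))
balanced-by-parity {P} {N} {suc zero} P≤N+1 N≤P+1 _ odd with ℕ.<-cmp P N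
... | tri≈ _ P≡N _ = refl , P≡N
... | tri< P<N _ _ =
  ⊥-elim (double-not-odd (P ℕ.+ 1) (subst (λ k → k % 2 ≡ 1) (trans (cong (λ k → P ℕ.+ (k ℕ.+ 1)) N≡P+1) (shift P)) odd))
  where
  N≡P+1 : N ≡ P ℕ.+ 1
  N≡P+1 = ℕ.≤-antisym N≤P+1 (subst (ℕ._≤ N) (ℕ.+-comm 1 P) P<N)
  shift : ∀ P → P ℕ.+ ((P ℕ.+ 1) ℕ.+ 1) ≡ (P ℕ.+ 1) ℕ.+ (P ℕ.+ 1)
  shift = solve-∀
... | tri> _ _ N<P =
  ⊥-elim (double-not-odd (N ℕ.+ 1) (subst (λ k → (k ℕ.+ (N ℕ.+ 1)) % 2 ≡ 1) P≡N+1 odd))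
  where
  P≡N+1 : P ≡ N ℕ.+ 1
  P≡N+1 = ℕ.≤-antisym P≤N+1 (subst (ℕ._≤ P) (ℕ.+-comm 1 N) N<P)
balanced-by-parity {z = suc (suc _)} _ _ (s≤s ()) _

half-of-odd : ∀ {m h} → m ℕ.+ (h ℕ.+ 1) ≡ suc (h ℕ.* 2) → m ≡ h
half-of-odd {m} {h} eq = ℕ.+-cancelʳ-≡ (h ℕ.+ 1) m h (trans eq (shift h))
  where
  shift : ∀ h → suc (h ℕ.* 2) ≡ h ℕ.+ (h ℕ.+ 1)
  shift = solve-∀

module OrderedField (R : RealField) where
  open RealField R renaming (+-mono-< to +-monoˡ-<)

  commutativeRing : CommutativeRing _ _
  commutativeRing = record { isCommutativeRing = isCommutativeRing }

  open CommutativeRing commutativeRing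
    using (+-comm; +-identityˡ; +-identityʳ; -‿inverseˡ; -‿inverseʳ; *-comm; *-identityʳ; zeroˡ; zeroʳ)
  open IntegerCoefficientSolver commutativeRing

  infix 4 _≤_
  _≤_ : ℝ → ℝ → Set
  x ≤ y = ¬ (y < x)

  <-asym : ∀ {x y} → x < y → ¬ (y < x)
  <-asym x<y y<x = <-irrefl _ (<-trans x<y y<x)

  <⇒≤ : ∀ {x y} → x < y → x ≤ y
  <⇒≤ = <-asym

  ≤-<-trans : ∀ {x y z} → x ≤ y → y < z → x < z
  ≤-<-trans {x} {y} {z} x≤y y<z with <-tri x z
  ... | tri< x<z _ _ = x<z
  ... | tri≈ _ refl _ = ⊥-elim (x≤y y<z)
  ... | tri> _ _ z<x = ⊥-elim (x≤y (<-trans y<z z<x))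

  _≟_ : (x y : ℝ) → Dec (x ≡ y)
  x ≟ y with <-tri x y
  ... | tri< _ x≢y _ = no x≢y
  ... | tri≈ _ x≡y _ = yes x≡y
  ... | tri> _ x≢y _ = no x≢y

  <⇒≢ : ∀ {x y} → x < y → x ≢ y
  <⇒≢ x<y refl = <-irrefl _ x<y

  >⇒≢ : ∀ {x y} → y < x → x ≢ y
  >⇒≢ y<x refl = <-irrefl _ y<x

  +-monoʳ-< : ∀ {x y} z → x < y → z + x < z + y
  +-monoʳ-< {x} {y} z x<y = subst₂ _<_ (+-comm x z) (+-comm y z) (+-monoˡ-< z x<y)

  +-mono-< : ∀ {a b c d} → a < b → c < d → a + c < b + d
  +-mono-< {b = b} {c = c} a<b c<d = <-trans (+-monoˡ-< c a<b) (+-monoʳ-< b c<d)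

  x<y⇒0<y-x : ∀ {x y} → x < y → 0ℝ < y - x
  x<y⇒0<y-x {x} {y} x<y = subst (_< y - x) (-‿inverseʳ x) (+-monoˡ-< (- x) x<y)

  0<y-x⇒x<y : ∀ {x y} → 0ℝ < y - x → x < y
  0<y-x⇒x<y {x} {y} 0<y-x =
    subst₂ _<_ (+-identityˡ x) (solve 2 (λ x y → (y :- x) :+ x := y) refl x y) (+-monoˡ-< x 0<y-x)

  -‿anti-< : ∀ {x y} → x < y → - y < - x
  -‿anti-< {x} {y} x<y = subst₂ _<_ (solve 2 (λ x y → x :+ (:- x :+ :- y) := :- y) refl x y)
                                   (solve 2 (λ x y → y :+ (:- x :+ :- y) := :- x) refl x y)
                                   (+-monoˡ-< (- x + - y) x<y)

  0<x⇒-x<0 : ∀ {x} → 0ℝ < x → - x < 0ℝ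
  0<x⇒-x<0 {x} 0<x = subst (- x <_) (solve 0 (:- numeral 0 := numeral 0) refl) (-‿anti-< 0<x)

  x<0⇒0<-x : ∀ {x} → x < 0ℝ → 0ℝ < - x
  x<0⇒0<-x {x} x<0 = subst (_< - x) (solve 0 (:- numeral 0 := numeral 0) refl) (-‿anti-< x<0)

  0<-x⇒x<0 : ∀ {x} → 0ℝ < - x → x < 0ℝ
  0<-x⇒x<0 {x} 0<-x =
    subst₂ _<_ (solve 1 (λ x → :- (:- x) := x) refl x) (solve 0 (:- numeral 0 := numeral 0) refl) (-‿anti-< 0<-x)

  x<y⇒x-y<0 : ∀ {x y} → x < y → x - y < 0ℝ
  x<y⇒x-y<0 {x} {y} x<y =
    0<-x⇒x<0 (subst (0ℝ <_) (solve 2 (λ x y → y :- x := :- (x :- y)) refl x y) (x<y⇒0<y-x x<y))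

  x-y<0⇒x<y : ∀ {x y} → x - y < 0ℝ → x < y
  x-y<0⇒x<y {x} {y} x-y<0 =
    0<y-x⇒x<y (subst (0ℝ <_) (solve 2 (λ x y → :- (x :- y) := y :- x) refl x y) (x<0⇒0<-x x-y<0))

  x-y≡0⇒x≡y : ∀ {x y} → x - y ≡ 0ℝ → x ≡ y
  x-y≡0⇒x≡y {x} {y} x-y≡0 = begin
    x             ≡⟨ solve 2 (λ x y → x := (x :- y) :+ y) refl x y ⟩
    (x - y) + y   ≡⟨ cong (_+ y) x-y≡0 ⟩
    0ℝ + y        ≡⟨ +-identityˡ y ⟩
    y             ∎
    where open ≡-Reasoning

  -x≡0⇒x≡0 : ∀ {x} → - x ≡ 0ℝ → x ≡ 0ℝ
  -x≡0⇒x≡0 {x} -x≡0 = trans (solve 1 (λ x → x := :- (:- x)) refl x) (trans (cong -_ -x≡0) (solve 0 (:- numeral 0 := numeral 0) refl))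

  combination≡0 : ∀ p q {s x} → s ≡ 0ℝ → x ≡ 0ℝ → p * s + q * x ≡ 0ℝ
  combination≡0 p q s≡0 x≡0 =
    trans (cong₂ (λ s x → p * s + q * x) s≡0 x≡0) (solve 2 (λ p q → p :* numeral 0 :+ q :* numeral 0 := numeral 0) refl p q)

  0<1 : 0ℝ < 1ℝ
  0<1 with <-tri 0ℝ 1ℝ
  ... | tri< 0<1 _ _ = 0<1
  ... | tri≈ _ 0≡1 _ = ⊥-elim (0≢1 0≡1)
  ... | tri> _ _ 1<0 = ⊥-elim (<-asym 1<0 (subst (0ℝ <_) (solve 0 (:- numeral 1 :* :- numeral 1 := numeral 1) refl)
                                                        (*-pos (x<0⇒0<-x 1<0) (x<0⇒0<-x 1<0))))

  *-pos-neg : ∀ {x y} → 0ℝ < x → y < 0ℝ → x * y < 0ℝ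
  *-pos-neg {x} {y} 0<x y<0 =
    0<-x⇒x<0 (subst (0ℝ <_) (solve 2 (λ x y → x :* (:- y) := :- (x :* y)) refl x y) (*-pos 0<x (x<0⇒0<-x y<0)))

  *-neg-neg : ∀ {x y} → x < 0ℝ → y < 0ℝ → 0ℝ < x * y
  *-neg-neg {x} {y} x<0 y<0 =
    subst (0ℝ <_) (solve 2 (λ x y → (:- x) :* (:- y) := x :* y) refl x y) (*-pos (x<0⇒0<-x x<0) (x<0⇒0<-x y<0))


  *-cancel-pos : ∀ {k x} → 0ℝ < k → 0ℝ < k * x → 0ℝ < x
  *-cancel-pos {k} {x} 0<k 0<kx with <-tri x 0ℝ
  ... | tri< x<0 _ _ = ⊥-elim (<-asym 0<kx (*-pos-neg 0<k x<0))
  ... | tri≈ _ refl _ = ⊥-elim (<-irrefl _ (subst (0ℝ <_) (zeroʳ k) 0<kx))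
  ... | tri> _ _ 0<x = 0<x

  *-cancel-neg : ∀ {k x} → 0ℝ < k → k * x < 0ℝ → x < 0ℝ
  *-cancel-neg {k} {x} 0<k kx<0 with <-tri x 0ℝ
  ... | tri< x<0 _ _ = x<0
  ... | tri≈ _ refl _ = ⊥-elim (<-irrefl _ (subst (_< 0ℝ) (zeroʳ k) kx<0))
  ... | tri> _ _ 0<x = ⊥-elim (<-asym kx<0 (*-pos 0<k 0<x))

  zero-product : ∀ {x y} → x * y ≡ 0ℝ → x ≡ 0ℝ ⊎ y ≡ 0ℝ
  zero-product {x} {y} xy≡0 with <-tri x 0ℝ | <-tri y 0ℝ
  ... | tri≈ _ x≡0 _ | _            = inj₁ x≡0
  ... | _            | tri≈ _ y≡0 _ = inj₂ y≡0
  ... | tri< x<0 _ _ | tri< y<0 _ _ = ⊥-elim (>⇒≢ (*-neg-neg x<0 y<0) xy≡0)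
  ... | tri< x<0 _ _ | tri> _ _ 0<y = ⊥-elim (<⇒≢ (subst (_< 0ℝ) (*-comm y x) (*-pos-neg 0<y x<0)) xy≡0)
  ... | tri> _ _ 0<x | tri< y<0 _ _ = ⊥-elim (<⇒≢ (*-pos-neg 0<x y<0) xy≡0)
  ... | tri> _ _ 0<x | tri> _ _ 0<y = ⊥-elim (>⇒≢ (*-pos 0<x 0<y) xy≡0)

  *-cancelˡ-≡0 : ∀ {k x} → k ≢ 0ℝ → k * x ≡ 0ℝ → x ≡ 0ℝ
  *-cancelˡ-≡0 k≢0 kx≡0 with zero-product kx≡0
  ... | inj₁ k≡0 = ⊥-elim (k≢0 k≡0)
  ... | inj₂ x≡0 = x≡0

  x≢0⇒0<x*x : ∀ {x} → x ≢ 0ℝ → 0ℝ < x * x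
  x≢0⇒0<x*x {x} x≢0 with <-tri x 0ℝ
  ... | tri< x<0 _ _ = *-neg-neg x<0 x<0
  ... | tri≈ _ x≡0 _ = ⊥-elim (x≢0 x≡0)
  ... | tri> _ _ 0<x = *-pos 0<x 0<x

  0≤x*x : ∀ x → 0ℝ ≤ x * x
  0≤x*x x with x ≟ 0ℝ
  ... | yes refl = <-irrefl _ ∘′ subst (_< 0ℝ) (zeroʳ 0ℝ)
  ... | no x≢0 = <⇒≤ (x≢0⇒0<x*x x≢0)

  0<x+y : ∀ {x y} → 0ℝ < x → 0ℝ ≤ y → 0ℝ < x + y
  0<x+y {x} {y} 0<x 0≤y with <-tri y 0ℝ
  ... | tri< y<0 _ _ = ⊥-elim (0≤y y<0)
  ... | tri≈ _ refl _ = subst (0ℝ <_) (sym (+-identityʳ x)) 0<x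
  ... | tri> _ _ 0<y = subst (_< x + y) (+-identityˡ 0ℝ) (+-mono-< 0<x 0<y)

  0≤*-pos : ∀ {k x} → 0ℝ < k → 0ℝ ≤ x → 0ℝ ≤ k * x
  0≤*-pos {k} {x} 0<k 0≤x kx<0 = 0≤x (*-cancel-neg 0<k kx<0)

  *-monoʳ-≤ : ∀ {x y z} → 0ℝ ≤ z → x ≤ y → x * z ≤ y * z
  *-monoʳ-≤ {x} {y} {z} 0≤z x≤y yz<xz with <-tri z 0ℝ
  ... | tri< z<0 _ _ = 0≤z z<0
  ... | tri≈ _ refl _ = <-irrefl _ (subst₂ _<_ (zeroʳ y) (zeroʳ x) yz<xz)
  ... | tri> _ _ 0<z = x≤y (0<y-x⇒x<y (*-cancel-pos 0<z
          (subst (0ℝ <_) (solve 3 (λ x y z → x :* z :- y :* z := z :* (x :- y)) refl x y z) (x<y⇒0<y-x yz<xz))))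

  0<[x+x]-d⇒0<x : ∀ {x d} → 0ℝ ≤ d → 0ℝ < (x + x) - d → 0ℝ < x
  0<[x+x]-d⇒0<x {x} {d} 0≤d 0<2x-d = *-cancel-pos (0<x+y 0<1 (<⇒≤ 0<1))
    (subst (0ℝ <_) (solve 2 (λ x d → ((x :+ x) :- d) :+ d := (numeral 1 :+ numeral 1) :* x) refl x d) (0<x+y 0<2x-d 0≤d))

  x<0⇒[x+x]-d<0 : ∀ {x d} → 0ℝ ≤ d → x < 0ℝ → (x + x) - d < 0ℝ
  x<0⇒[x+x]-d<0 {x} {d} 0≤d x<0 = 0<-x⇒x<0
    (subst (0ℝ <_) (solve 2 (λ x d → (:- x :+ :- x) :+ d := :- ((x :+ x) :- d)) refl x d)
      (0<x+y (subst (_< - x + - x) (+-identityˡ 0ℝ) (+-mono-< (x<0⇒0<-x x<0) (x<0⇒0<-x x<0))) 0≤d))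

  abs : ℝ → ℝ
  abs x with <-tri x 0ℝ
  ... | tri< _ _ _ = - x
  ... | tri≈ _ _ _ = x
  ... | tri> _ _ _ = x

  abs-pos : ∀ {x} → x ≢ 0ℝ → 0ℝ < abs x
  abs-pos {x} x≢0 with <-tri x 0ℝ
  ... | tri< x<0 _ _ = x<0⇒0<-x x<0
  ... | tri≈ _ x≡0 _ = ⊥-elim (x≢0 x≡0)
  ... | tri> _ _ 0<x = 0<x

  abs-nonneg : ∀ x → 0ℝ ≤ abs x
  abs-nonneg x with <-tri x 0ℝ
  ... | tri< x<0 _ _ = <⇒≤ (x<0⇒0<-x x<0)
  ... | tri≈ _ refl _ = <-irrefl _
  ... | tri> _ _ 0<x = <⇒≤ 0<x

  abs-of-pos : ∀ {x} → 0ℝ < x → abs x ≡ x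
  abs-of-pos {x} 0<x with <-tri x 0ℝ
  ... | tri< x<0 _ _ = ⊥-elim (<-asym x<0 0<x)
  ... | tri≈ _ _ _ = refl
  ... | tri> _ _ _ = refl

  abs-of-neg : ∀ {x} → x < 0ℝ → abs x ≡ - x
  abs-of-neg {x} x<0 with <-tri x 0ℝ
  ... | tri< _ _ _ = refl
  ... | tri≈ _ x≡0 _ = ⊥-elim (<⇒≢ x<0 x≡0)
  ... | tri> _ _ 0<x = ⊥-elim (<-asym x<0 0<x)

  abs+x-nonneg : ∀ x → 0ℝ ≤ abs x + x
  abs+x-nonneg x with <-tri x 0ℝ
  ... | tri< _ _ _ = <-irrefl _ ∘′ subst (_< 0ℝ) (-‿inverseˡ x)
  ... | tri≈ _ refl _ = <-irrefl _ ∘′ subst (_< 0ℝ) (+-identityˡ 0ℝ)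
  ... | tri> _ _ 0<x = <⇒≤ (0<x+y 0<x (<⇒≤ 0<x))

  abs-x-nonneg : ∀ x → 0ℝ ≤ abs x - x
  abs-x-nonneg x with <-tri x 0ℝ
  ... | tri< x<0 _ _ = <⇒≤ (0<x+y (x<0⇒0<-x x<0) (<⇒≤ (x<0⇒0<-x x<0)))
  ... | tri≈ _ refl _ = <-irrefl _ ∘′ subst (_< 0ℝ) (-‿inverseʳ 0ℝ)
  ... | tri> _ _ _ = <-irrefl _ ∘′ subst (_< 0ℝ) (-‿inverseʳ x)

  SameSign : ℝ → ℝ → Set
  SameSign p r = (0ℝ < p → 0ℝ < r) × (p < 0ℝ → r < 0ℝ)

  sameSign-≢0 : ∀ {p r} → p ≢ 0ℝ → SameSign p r → r ≢ 0ℝ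
  sameSign-≢0 {p} p≢0 (pos , neg) with <-tri p 0ℝ
  ... | tri< p<0 _ _ = <⇒≢ (neg p<0)
  ... | tri≈ _ p≡0 _ = ⊥-elim (p≢0 p≡0)
  ... | tri> _ _ 0<p = >⇒≢ (pos 0<p)

  ±ε-slack : ∀ {ε t} q → 0ℝ < ε → t ≡ ε ⊎ t ≡ - ε → 0ℝ ≤ ε * abs q + t * q × 0ℝ ≤ ε * abs q - t * q
  ±ε-slack {ε} q 0<ε (inj₁ refl) =
      subst (0ℝ ≤_) (solve 3 (λ e a q → e :* (a :+ q) := e :* a :+ e :* q) refl ε (abs q) q) (0≤*-pos 0<ε (abs+x-nonneg q))
    , subst (0ℝ ≤_) (solve 3 (λ e a q → e :* (a :- q) := e :* a :- e :* q) refl ε (abs q) q) (0≤*-pos 0<ε (abs-x-nonneg q))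
  ±ε-slack {ε} q 0<ε (inj₂ refl) =
      subst (0ℝ ≤_) (solve 3 (λ e a q → e :* (a :- q) := e :* a :+ (:- e) :* q) refl ε (abs q) q) (0≤*-pos 0<ε (abs-x-nonneg q))
    , subst (0ℝ ≤_) (solve 3 (λ e a q → e :* (a :+ q) := e :* a :- (:- e) :* q) refl ε (abs q) q) (0≤*-pos 0<ε (abs+x-nonneg q))

  sameSign-perturb : ∀ {ε t p q} → 0ℝ < ε → ε * abs q < abs p → t ≡ ε ⊎ t ≡ - ε → SameSign p (p + t * q)
  sameSign-perturb {ε} {t} {p} {q} 0<ε ε|q|<|p| t≡±ε = stays-pos , stays-neg
    where
    slack : 0ℝ ≤ ε * abs q + t * q × 0ℝ ≤ ε * abs q - t * q
    slack = ±ε-slack q 0<ε t≡±ε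
    stays-pos : 0ℝ < p → 0ℝ < p + t * q
    stays-pos 0<p =
      subst (0ℝ <_) (solve 4 (λ p e t q → (p :- e) :+ (e :+ t :* q) := p :+ t :* q) refl p (ε * abs q) t q)
            (0<x+y (x<y⇒0<y-x (subst (ε * abs q <_) (abs-of-pos 0<p) ε|q|<|p|)) (proj₁ slack))
    stays-neg : p < 0ℝ → p + t * q < 0ℝ
    stays-neg p<0 = 0<-x⇒x<0
      (subst (0ℝ <_) (solve 4 (λ p e t q → (:- p :- e) :+ (e :- t :* q) := :- (p :+ t :* q)) refl p (ε * abs q) t q)
             (0<x+y (x<y⇒0<y-x (subst (ε * abs q <_) (abs-of-neg p<0) ε|q|<|p|)) (proj₂ slack)))

  -- ε = c / (c + d), so that ε c + ε d = c with ε c > 0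
  ∃-bound : ∀ {c d} → 0ℝ < c → 0ℝ ≤ d → ∃[ ε ] (0ℝ < ε × ε * d < c)
  ∃-bound {c} {d} 0<c 0≤d with inverse (c + d) (>⇒≢ (0<x+y 0<c 0≤d))
  ... | i , [c+d]i≡1 =
    c * i , 0<ci , subst₂ _<_ (+-identityˡ (c * i * d)) ci*c+ci*d≡c (+-monoˡ-< (c * i * d) (*-pos 0<ci 0<c))
    where
    0<i : 0ℝ < i
    0<i = *-cancel-pos (0<x+y 0<c 0≤d) (subst (0ℝ <_) (sym [c+d]i≡1) 0<1)
    0<ci : 0ℝ < c * i
    0<ci = *-pos 0<c 0<i
    ci*c+ci*d≡c : c * i * c + c * i * d ≡ c
    ci*c+ci*d≡c = begin
      c * i * c + c * i * d ≡⟨ solve 3 (λ c i d → c :* i :* c :+ c :* i :* d := c :* ((c :+ d) :* i)) refl c i d ⟩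
      c * ((c + d) * i)     ≡⟨ cong (c *_) [c+d]i≡1 ⟩
      c * 1ℝ                ≡⟨ *-identityʳ c ⟩
      c                     ∎
      where open ≡-Reasoning

  SmallFor : ℝ → List (ℝ × ℝ) → Set
  SmallFor ε ps = ∀ {p q} → (p , q) ∈ ps → p ≢ 0ℝ → ε * abs q < abs p

  shrink-bound : ∀ {ε ε′ p q} → ε′ ≤ ε → ε * abs q < abs p → ε′ * abs q < abs p
  shrink-bound ε′≤ε = ≤-<-trans (*-monoʳ-≤ (abs-nonneg _) ε′≤ε)

  shrink : ∀ {ε ε′ ps} → ε′ ≤ ε → SmallFor ε ps → SmallFor ε′ ps
  shrink ε′≤ε small m p≢0 = shrink-bound ε′≤ε (small m p≢0)

  smallFor-∷ : ∀ {ε p q ps} → SmallFor ε ps → (p ≢ 0ℝ → ε * abs q < abs p) → SmallFor ε ((p , q) ∷ ps)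
  smallFor-∷ small bound (here refl) = bound
  smallFor-∷ small bound (there m)   = small m

  smallFor-min : ∀ {ε δ p q ps} → 0ℝ < ε → 0ℝ < δ → SmallFor ε ps → δ * abs q < abs p →
                 ∃[ η ] (0ℝ < η × SmallFor η ((p , q) ∷ ps))
  smallFor-min {ε} {δ} 0<ε 0<δ small bound with <-tri ε δ
  ... | tri< ε<δ _ _ = ε , 0<ε , smallFor-∷ small (λ _ → shrink-bound (<⇒≤ ε<δ) bound)
  ... | tri≈ δ≤ε _ _ = δ , 0<δ , smallFor-∷ (shrink δ≤ε small) (λ _ → bound)
  ... | tri> δ≤ε _ _ = δ , 0<δ , smallFor-∷ (shrink δ≤ε small) (λ _ → bound)

  ∃-smallFor : (ps : List (ℝ × ℝ)) → ∃[ ε ] (0ℝ < ε × SmallFor ε ps)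
  ∃-smallFor []             = 1ℝ , 0<1 , λ ()
  ∃-smallFor ((p , q) ∷ ps) = extend (∃-smallFor ps) (p ≟ 0ℝ)
    where
    extend : ∃[ ε ] (0ℝ < ε × SmallFor ε ps) → Dec (p ≡ 0ℝ) → ∃[ ε ] (0ℝ < ε × SmallFor ε ((p , q) ∷ ps))
    extend (ε , 0<ε , small) (yes p≡0) = ε , 0<ε , smallFor-∷ small (λ p≢0 → ⊥-elim (p≢0 p≡0))
    extend (ε , 0<ε , small) (no p≢0) =
      let δ , 0<δ , bound = ∃-bound (abs-pos p≢0) (abs-nonneg q) in smallFor-min 0<ε 0<δ small bound

  record SmallPerturbation (ps : List (ℝ × ℝ)) : Set where
    field
      ε          : ℝ
      0<ε        : 0ℝ < ε
      keeps-sign : ∀ {p q t} → (p , q) ∈ ps → p ≢ 0ℝ → t ≡ ε ⊎ t ≡ - ε → SameSign p (p + t * q)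

  small-perturbation : ∀ ps → SmallPerturbation ps
  small-perturbation ps =
    let ε , 0<ε , small = ∃-smallFor ps
    in record { ε = ε ; 0<ε = 0<ε ; keeps-sign = λ m p≢0 t≡±ε → sameSign-perturb 0<ε (small m p≢0) t≡±ε }

  posᵇ negᵇ zeroᵇ : ℝ → Bool
  posᵇ x = 0ℝ <ᵇ x
  negᵇ x = x <ᵇ 0ℝ
  zeroᵇ x = x ≡ᵇ 0ℝ

  <⇒<ᵇ : ∀ {x y} → x < y → (x <ᵇ y) ≡ true
  <⇒<ᵇ {x} {y} x<y with <-tri x y
  ... | tri< _ _ _ = refl
  ... | tri≈ x≮y _ _ = ⊥-elim (x≮y x<y)
  ... | tri> x≮y _ _ = ⊥-elim (x≮y x<y)

  ≮⇒<ᵇ≡false : ∀ {x y} → ¬ (x < y) → (x <ᵇ y) ≡ false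
  ≮⇒<ᵇ≡false {x} {y} x≮y with <-tri x y
  ... | tri< x<y _ _ = ⊥-elim (x≮y x<y)
  ... | tri≈ _ _ _ = refl
  ... | tri> _ _ _ = refl

  <ᵇ⇒< : ∀ {x y} → (x <ᵇ y) ≡ true → x < y
  <ᵇ⇒< {x} {y} _ with <-tri x y
  <ᵇ⇒< _ | tri< x<y _ _ = x<y

  <ᵇ-cong : ∀ {x y z w} → (x < y → z < w) → (z < w → x < y) → (x <ᵇ y) ≡ (z <ᵇ w)
  <ᵇ-cong {z = z} {w} to from with <-tri z w
  ... | tri< z<w _ _ = <⇒<ᵇ (from z<w)
  ... | tri≈ z≮w _ _ = ≮⇒<ᵇ≡false (z≮w ∘′ to)
  ... | tri> z≮w _ _ = ≮⇒<ᵇ≡false (z≮w ∘′ to)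

  ≡⇒≡ᵇ : ∀ {x y} → x ≡ y → (x ≡ᵇ y) ≡ true
  ≡⇒≡ᵇ {x} {y} x≡y with <-tri x y
  ... | tri< _ x≢y _ = ⊥-elim (x≢y x≡y)
  ... | tri≈ _ _ _ = refl
  ... | tri> _ x≢y _ = ⊥-elim (x≢y x≡y)

  ≢⇒≡ᵇ≡false : ∀ {x y} → x ≢ y → (x ≡ᵇ y) ≡ false
  ≢⇒≡ᵇ≡false {x} {y} x≢y with <-tri x y
  ... | tri< _ _ _ = refl
  ... | tri≈ _ x≡y _ = ⊥-elim (x≢y x≡y)
  ... | tri> _ _ _ = refl

  ≡ᵇ⇒≡ : ∀ {x y} → (x ≡ᵇ y) ≡ true → x ≡ y
  ≡ᵇ⇒≡ {x} {y} _ with <-tri x y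
  ≡ᵇ⇒≡ _ | tri≈ _ x≡y _ = x≡y

  ≡ᵇ-cong : ∀ {x y z w} → (x ≡ y → z ≡ w) → (z ≡ w → x ≡ y) → (x ≡ᵇ y) ≡ (z ≡ᵇ w)
  ≡ᵇ-cong {z = z} {w} to from with <-tri z w
  ... | tri< _ z≢w _ = ≢⇒≡ᵇ≡false (z≢w ∘′ to)
  ... | tri≈ _ z≡w _ = ≡⇒≡ᵇ (from z≡w)
  ... | tri> _ z≢w _ = ≢⇒≡ᵇ≡false (z≢w ∘′ to)

  posᵇ-zero : ∀ {x} → x ≡ 0ℝ → posᵇ x ≡ false
  posᵇ-zero x≡0 = ≮⇒<ᵇ≡false (λ 0<x → >⇒≢ 0<x x≡0)

  negᵇ-zero : ∀ {x} → x ≡ 0ℝ → negᵇ x ≡ false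
  negᵇ-zero x≡0 = ≮⇒<ᵇ≡false (λ x<0 → <⇒≢ x<0 x≡0)

  not-posᵇ : ∀ x → not (posᵇ x) ≡ (negᵇ x ∨ zeroᵇ x)
  not-posᵇ x with <-tri x 0ℝ
  ... | tri< x<0 _ _ = cong not (≮⇒<ᵇ≡false (<-asym x<0))
  ... | tri≈ _ x≡0 _ = cong not (posᵇ-zero x≡0)
  ... | tri> _ _ 0<x = cong not (<⇒<ᵇ 0<x)

  posᵇ-perturb : ∀ {p q} → (p ≢ 0ℝ → SameSign p (p + q)) → posᵇ (p + q) ≡ (posᵇ p ∨ (zeroᵇ p ∧ posᵇ q))
  posᵇ-perturb {p} {q} kept with <-tri p 0ℝ
  ... | tri< p<0 _ _ rewrite ≮⇒<ᵇ≡false (<-asym p<0) = ≮⇒<ᵇ≡false (<-asym (proj₂ (kept (<⇒≢ p<0)) p<0))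
  ... | tri≈ _ refl _ rewrite ≮⇒<ᵇ≡false (<-irrefl 0ℝ) = cong posᵇ (+-identityˡ q)
  ... | tri> _ _ 0<p rewrite <⇒<ᵇ 0<p = <⇒<ᵇ (proj₁ (kept (>⇒≢ 0<p)) 0<p)

  negᵇ-perturb : ∀ {p q} → (p ≢ 0ℝ → SameSign p (p + q)) → negᵇ (p + q) ≡ (negᵇ p ∨ (zeroᵇ p ∧ negᵇ q))
  negᵇ-perturb {p} {q} kept with <-tri p 0ℝ
  ... | tri< p<0 _ _ = <⇒<ᵇ (proj₂ (kept (<⇒≢ p<0)) p<0)
  ... | tri≈ _ refl _ = cong negᵇ (+-identityˡ q)
  ... | tri> _ _ 0<p = ≮⇒<ᵇ≡false (<-asym (proj₁ (kept (>⇒≢ 0<p)) 0<p))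

  posᵇ-*-pos : ∀ {k x} → 0ℝ < k → posᵇ (k * x) ≡ posᵇ x
  posᵇ-*-pos 0<k = <ᵇ-cong (*-cancel-pos 0<k) (*-pos 0<k)

  negᵇ-*-pos : ∀ {k x} → 0ℝ < k → negᵇ (k * x) ≡ negᵇ x
  negᵇ-*-pos 0<k = <ᵇ-cong (*-cancel-neg 0<k) (*-pos-neg 0<k)

  posᵇ-neg : ∀ x → posᵇ (- x) ≡ negᵇ x
  posᵇ-neg x = <ᵇ-cong 0<-x⇒x<0 x<0⇒0<-x

  negᵇ-neg : ∀ x → negᵇ (- x) ≡ posᵇ x
  negᵇ-neg x = <ᵇ-cong (λ -x<0 → subst (0ℝ <_) (solve 1 (λ x → :- (:- x) := x) refl x) (x<0⇒0<-x -x<0)) 0<x⇒-x<0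

  posᵇ-*-neg : ∀ {k x} → 0ℝ < k → posᵇ ((- k) * x) ≡ negᵇ x
  posᵇ-*-neg {k} {x} 0<k = begin
    posᵇ ((- k) * x) ≡⟨ cong posᵇ (solve 2 (λ k x → (:- k) :* x := :- (k :* x)) refl k x) ⟩
    posᵇ (- (k * x)) ≡⟨ posᵇ-neg (k * x) ⟩
    negᵇ (k * x)     ≡⟨ negᵇ-*-pos 0<k ⟩
    negᵇ x           ∎
    where open ≡-Reasoning

  negᵇ-*-neg : ∀ {k x} → 0ℝ < k → negᵇ ((- k) * x) ≡ posᵇ x
  negᵇ-*-neg {k} {x} 0<k = begin
    negᵇ ((- k) * x) ≡⟨ cong negᵇ (solve 2 (λ k x → (:- k) :* x := :- (k :* x)) refl k x) ⟩
    negᵇ (- (k * x)) ≡⟨ negᵇ-neg (k * x) ⟩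
    posᵇ (k * x)     ≡⟨ posᵇ-*-pos 0<k ⟩
    posᵇ x           ∎
    where open ≡-Reasoning

  posᵇ⇒zeroᵇ≡false : ∀ {x} → posᵇ x ≡ true → zeroᵇ x ≡ false
  posᵇ⇒zeroᵇ≡false = ≢⇒≡ᵇ≡false ∘′ >⇒≢ ∘′ <ᵇ⇒<

  negᵇ⇒zeroᵇ≡false : ∀ {x} → negᵇ x ≡ true → zeroᵇ x ≡ false
  negᵇ⇒zeroᵇ≡false = ≢⇒≡ᵇ≡false ∘′ <⇒≢ ∘′ <ᵇ⇒<

  module _ {K s x L} (0<K : 0ℝ < K) (Ks≡xL : K * s ≡ x * L) where

    sign-transfer⁺ : 0ℝ < L → posᵇ s ≡ posᵇ x × negᵇ s ≡ negᵇ x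
    sign-transfer⁺ 0<L = transfer posᵇ posᵇ-*-pos , transfer negᵇ negᵇ-*-pos
      where
      transfer : ∀ (σ : ℝ → Bool) → (∀ {k x} → 0ℝ < k → σ (k * x) ≡ σ x) → σ s ≡ σ x
      transfer σ σ-*-pos = begin
        σ s       ≡⟨ sym (σ-*-pos 0<K) ⟩
        σ (K * s) ≡⟨ cong σ (trans Ks≡xL (*-comm x L)) ⟩
        σ (L * x) ≡⟨ σ-*-pos 0<L ⟩
        σ x       ∎
        where open ≡-Reasoning

    sign-transfer⁻ : L < 0ℝ → posᵇ s ≡ negᵇ x × negᵇ s ≡ posᵇ x
    sign-transfer⁻ L<0 = transfer posᵇ negᵇ posᵇ-*-pos posᵇ-*-neg , transfer negᵇ posᵇ negᵇ-*-pos negᵇ-*-neg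
      where
      transfer : ∀ (σ τ : ℝ → Bool) → (∀ {k x} → 0ℝ < k → σ (k * x) ≡ σ x) →
                 (∀ {k x} → 0ℝ < k → σ ((- k) * x) ≡ τ x) → σ s ≡ τ x
      transfer σ τ σ-*-pos σ-*-neg = begin
        σ s              ≡⟨ sym (σ-*-pos 0<K) ⟩
        σ (K * s)        ≡⟨ cong σ (trans Ks≡xL (solve 2 (λ x L → x :* L := (:- (:- L)) :* x) refl x L)) ⟩
        σ (- (- L) * x)  ≡⟨ σ-*-neg (x<0⇒0<-x L<0) ⟩
        τ x              ∎
        where open ≡-Reasoning

    sign-transfer⁰ : L ≡ 0ℝ → s ≡ 0ℝ
    sign-transfer⁰ L≡0 = *-cancelˡ-≡0 (>⇒≢ 0<K) (trans Ks≡xL (trans (cong (x *_) L≡0) (zeroʳ x)))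

module Counting (R : RealField) where
  open Plane R
  open Data.Nat using (_+_; _≤_; _<_)

  private
    variable
      p q r : Point → Bool
      S : List Point

  count-cong : ∀ S → (∀ {y} → y ∈ S → p y ≡ q y) → count p S ≡ count q S
  count-cong [] eq = refl
  count-cong {p = p} {q = q} (y ∷ S) eq with p y | q y | eq (here refl)
  ... | true  | true  | _ = cong suc (count-cong S (eq ∘ there))
  ... | false | false | _ = count-cong S (eq ∘ there)

  count-mono : ∀ S → (∀ {y} → y ∈ S → p y ≡ true → q y ≡ true) → count p S ≤ count q S
  count-mono [] p⇒q = z≤n
  count-mono {p = p} {q = q} (y ∷ S) p⇒q with p y | q y | p⇒q (here refl)
  ... | true  | true  | _ = s≤s (count-mono S (p⇒q ∘ there))
  ... | true  | false | p⇒q-y with () ← p⇒q-y refl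
  ... | false | true  | _ = ℕ.m≤n⇒m≤1+n (count-mono S (p⇒q ∘ there))
  ... | false | false | _ = count-mono S (p⇒q ∘ there)

  count-mono-< : (∀ {y} → y ∈ S → p y ≡ true → q y ≡ true) →
                 ∀ {w} → w ∈ S → q w ≡ true → p w ≡ false → count p S < count q S
  count-mono-< {S = y ∷ S} {p = p} {q = q} p⇒q (here refl) qw pw with p y | q y
  count-mono-< {S = _ ∷ S} p⇒q (here refl) refl refl | false | true = s≤s (count-mono S (p⇒q ∘ there))
  count-mono-< {S = y ∷ S} {p = p} {q = q} p⇒q (there w∈S) qw pw with p y | q y | p⇒q (here refl)
  ... | true  | true  | _     = s≤s (count-mono-< (p⇒q ∘ there) w∈S qw pw)
  ... | true  | false | p⇒q-y with () ← p⇒q-y refl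
  ... | false | true  | _     = ℕ.m≤n⇒m≤1+n (count-mono-< (p⇒q ∘ there) w∈S qw pw)
  ... | false | false | _     = count-mono-< (p⇒q ∘ there) w∈S qw pw

  count-∨ : ∀ S → (∀ {y} → y ∈ S → r y ≡ (p y ∨ q y)) → (∀ {y} → y ∈ S → p y ≡ true → q y ≡ false) →
            count r S ≡ count p S + count q S
  count-∨ [] r≡p∨q disjoint = refl
  count-∨ {r = r} {p = p} {q = q} (y ∷ S) r≡p∨q disjoint
    with r y | p y | q y | r≡p∨q (here refl) | disjoint (here refl)
  ... | true  | true  | false | _ | _ = cong suc (count-∨ S (r≡p∨q ∘ there) (disjoint ∘ there))
  ... | true  | false | true  | _ | _ = trans (cong suc (count-∨ S (r≡p∨q ∘ there) (disjoint ∘ there))) (sym (ℕ.+-suc _ _))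
  ... | false | false | false | _ | _ = count-∨ S (r≡p∨q ∘ there) (disjoint ∘ there)
  ... | true  | true  | true  | _ | disjoint-y with () ← disjoint-y refl
  ... | false | true  | _     | () | _
  ... | false | false | true  | () | _
  ... | true  | false | false | () | _

  count-not : ∀ (p : Point → Bool) S → count p S + count (not ∘ p) S ≡ length S
  count-not p [] = refl
  count-not p (y ∷ S) with p y
  ... | true  = cong suc (count-not p S)
  ... | false = trans (ℕ.+-suc _ _) (cong suc (count-not p S))

  count-none : ∀ S → (∀ {y} → y ∈ S → p y ≡ false) → count p S ≡ 0
  count-none [] none = refl
  count-none {p = p} (y ∷ S) none with p y | none (here refl)
  ... | false | _ = count-none S (none ∘ there)

  count-∷-false : ∀ S {y} → p y ≡ false → count p (y ∷ S) ≡ count p S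
  count-∷-false S py rewrite py = refl

  count-∷-true : ∀ S {y} → p y ≡ true → count p (y ∷ S) ≡ suc (count p S)
  count-∷-true S py rewrite py = refl

  count-pos : ∀ {w} → w ∈ S → p w ≡ true → 0 < count p S
  count-pos {S = y ∷ S} {p = p} (here refl) pw with p y
  count-pos (here refl) refl | true = s≤s z≤n
  count-pos {S = y ∷ S} {p = p} (there w∈S) pw with p y
  ... | true  = s≤s z≤n
  ... | false = count-pos w∈S pw

  count-witness : 0 < count p S → ∃[ y ] (y ∈ S × p y ≡ true)
  count-witness {p = p} {S = y ∷ S} 0<count with p y in py
  ... | true  = y , here refl , py
  ... | false with count-witness 0<count
  ...   | z , z∈S , pz = z , there z∈S , pz

  count-≤-length : ∀ (p : Point → Bool) S → count p S ≤ length S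
  count-≤-length p [] = z≤n
  count-≤-length p (y ∷ S) with p y
  ... | true  = s≤s (count-≤-length p S)
  ... | false = ℕ.m≤n⇒m≤1+n (count-≤-length p S)

  count-≤1 : Unique S → ∀ {w} → (∀ {y} → y ∈ S → p y ≡ true → y ≡ w) → count p S ≤ 1
  count-≤1 {S = []} _ _ = z≤n
  count-≤1 {S = y ∷ S} {p = p} (y∉S ∷ unique) {w} only-w with p y in py
  ... | false = count-≤1 unique (only-w ∘ there)
  ... | true  = s≤s (subst (_≤ 0) (sym (count-none S none)) z≤n)
    where
    none : ∀ {z} → z ∈ S → p z ≡ false
    none {z} z∈S with p z in pz
    ... | false = refl
    ... | true  = ⊥-elim (All.lookup y∉S z∈S (trans (only-w (here refl) py) (sym (only-w (there z∈S) pz))))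

  count≡1 : Unique S → ∀ {w} → w ∈ S → p w ≡ true → (∀ {y} → y ∈ S → p y ≡ true → y ≡ w) → count p S ≡ 1
  count≡1 unique w∈S pw only-w = ℕ.≤-antisym (count-≤1 unique only-w) (count-pos w∈S pw)

  count-filterᵇ : ∀ (p q : Point → Bool) S → count p (filterᵇ q S) ≡ count (λ y → q y ∧ p y) S
  count-filterᵇ p q [] = refl
  count-filterᵇ p q (y ∷ S) with q y
  ... | false = count-filterᵇ p q S
  ... | true with p y
  ...   | true  = cong suc (count-filterᵇ p q S)
  ...   | false = count-filterᵇ p q S

  count-filterᵇ-⊇ : ∀ S → (∀ {y} → y ∈ S → p y ≡ true → q y ≡ true) → count p (filterᵇ q S) ≡ count p S
  count-filterᵇ-⊇ [] p⇒q = refl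
  count-filterᵇ-⊇ {p = p} {q = q} (y ∷ S) p⇒q with q y in qy
  ... | true with p y
  ...   | true  = cong suc (count-filterᵇ-⊇ S (p⇒q ∘ there))
  ...   | false = count-filterᵇ-⊇ S (p⇒q ∘ there)
  count-filterᵇ-⊇ {p = p} {q = q} (y ∷ S) p⇒q | false with p y in py
  ...   | true  with () ← trans (sym qy) (p⇒q (here refl) py)
  ...   | false = count-filterᵇ-⊇ S (p⇒q ∘ there)

  count-∧-none : ∀ S → (∀ {y} → y ∈ S → q y ≡ true → p y ≡ false) → count (λ y → q y ∧ p y) S ≡ 0
  count-∧-none [] none = refl
  count-∧-none {q = q} {p = p} (y ∷ S) none with q y in qy
  ... | false = count-∧-none S (none ∘ there)
  ... | true rewrite none (here refl) qy = count-∧-none S (none ∘ there)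

  count-∧-cong : ∀ S → (∀ {y} → y ∈ S → q y ≡ true → p y ≡ r y) →
                 count (λ y → q y ∧ p y) S ≡ count (λ y → q y ∧ r y) S
  count-∧-cong [] eq = refl
  count-∧-cong {q = q} {p = p} {r = r} (y ∷ S) eq with q y in qy
  ... | false = count-∧-cong S (eq ∘ there)
  ... | true rewrite eq (here refl) qy with r y
  ...   | true  = cong suc (count-∧-cong S (eq ∘ there))
  ...   | false = count-∧-cong S (eq ∘ there)

  count-split : ∀ (p q : Point → Bool) S → count p S ≡ count (λ y → not (q y) ∧ p y) S + count (λ y → q y ∧ p y) S
  count-split p q [] = refl
  count-split p q (y ∷ S) with q y | p y
  ... | true  | true  = trans (cong suc (count-split p q S)) (sym (ℕ.+-suc _ _))
  ... | true  | false = count-split p q S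
  ... | false | true  = cong suc (count-split p q S)
  ... | false | false = count-split p q S

module VoronoiGame (R : RealField) where
  open RealField R hiding (+-mono-<)
  open Plane R
  open OrderedField R
  open Counting R
  open CommutativeRing commutativeRing using (+-comm; +-identityˡ; +-identityʳ; -‿inverseʳ; *-comm; zeroˡ; zeroʳ)
  open IntegerCoefficientSolver commutativeRing

  -- Coordinates relative to a line through a point

  Nondegenerate : ℝ → ℝ → Set
  Nondegenerate a b = ¬ (a ≡ 0ℝ × b ≡ 0ℝ)

  -- For the line through c with normal (a, b): side is the signed distance of y from it, axial the
  -- position of y along it in direction (-b, a), both scaled by |(a, b)|.
  side axial : ℝ → ℝ → Point → Point → ℝ
  side  a b (c₁ , c₂) (y₁ , y₂) = a * (y₁ - c₁) + b * (y₂ - c₂)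
  axial a b (c₁ , c₂) (y₁ , y₂) = (- b) * (y₁ - c₁) + a * (y₂ - c₂)

  above below on ray⁺ ray⁻ : ℝ → ℝ → Point → List Point → ℕ
  above a b c = count (λ y → posᵇ (side a b c y))
  below a b c = count (λ y → negᵇ (side a b c y))
  on    a b c = count (λ y → zeroᵇ (side a b c y))
  ray⁺  a b c = count (λ y → zeroᵇ (side a b c y) ∧ posᵇ (axial a b c y))
  ray⁻  a b c = count (λ y → zeroᵇ (side a b c y) ∧ negᵇ (axial a b c y))

  Halving RayBalanced : List Point → Point → Set
  Halving     S c = ∀ a b → Nondegenerate a b → above a b c S ≡ below a b c S
  RayBalanced S c = ∀ a b → Nondegenerate a b → ray⁺ a b c S ≡ ray⁻ a b c S

  above+below+on : ∀ a b c S → above a b c S ℕ.+ (below a b c S ℕ.+ on a b c S) ≡ length S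
  above+below+on a b c S = trans
    (cong (above a b c S ℕ.+_) (sym (count-∨ S (λ {y} _ → not-posᵇ (side a b c y)) (λ _ → negᵇ⇒zeroᵇ≡false))))
    (count-not _ S)

  lineThrough : (a b : ℝ) → Point → Nondegenerate a b → Line
  lineThrough a b (c₁ , c₂) nd = line a b (a * c₁ + b * c₂) nd

  sumOfSquares-pos : ∀ {a b} → Nondegenerate a b → 0ℝ < a * a + b * b
  sumOfSquares-pos {a} {b} nd with a ≟ 0ℝ | b ≟ 0ℝ
  ... | yes a≡0 | yes b≡0 = ⊥-elim (nd (a≡0 , b≡0))
  ... | no a≢0  | _       = 0<x+y (x≢0⇒0<x*x a≢0) (0≤x*x b)
  ... | yes _   | no b≢0  = subst (0ℝ <_) (+-comm (b * b) (a * a)) (0<x+y (x≢0⇒0<x*x b≢0) (0≤x*x a))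

  nondegenerate-cancel : ∀ {a b s} → Nondegenerate a b → a * s ≡ 0ℝ → b * s ≡ 0ℝ → s ≡ 0ℝ
  nondegenerate-cancel nd as≡0 bs≡0 with zero-product as≡0 | zero-product bs≡0
  ... | inj₂ s≡0 | _        = s≡0
  ... | _        | inj₂ s≡0 = s≡0
  ... | inj₁ a≡0 | inj₁ b≡0 = ⊥-elim (nd (a≡0 , b≡0))

  side≡0∧axial≡0⇒≡ : ∀ {a b c w} → Nondegenerate a b → side a b c w ≡ 0ℝ → axial a b c w ≡ 0ℝ → w ≡ c
  side≡0∧axial≡0⇒≡ {a} {b} {c₁ , c₂} {w₁ , w₂} nd s≡0 x≡0 = cong₂ _,_
    (x-y≡0⇒x≡y (*-cancelˡ-≡0 N≢0 (trans recover₁ (combination≡0 a (- b) s≡0 x≡0))))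
    (x-y≡0⇒x≡y (*-cancelˡ-≡0 N≢0 (trans recover₂ (combination≡0 b a s≡0 x≡0))))
    where
    N≢0 : a * a + b * b ≢ 0ℝ
    N≢0 = >⇒≢ (sumOfSquares-pos nd)
    recover₁ : (a * a + b * b) * (w₁ - c₁) ≡ a * side a b (c₁ , c₂) (w₁ , w₂) + (- b) * axial a b (c₁ , c₂) (w₁ , w₂)
    recover₁ = solve 6 (λ a b w₁ c₁ w₂ c₂ → (a :* a :+ b :* b) :* (w₁ :- c₁)
                 := a :* (a :* (w₁ :- c₁) :+ b :* (w₂ :- c₂)) :+ (:- b) :* ((:- b) :* (w₁ :- c₁) :+ a :* (w₂ :- c₂)))
               refl a b w₁ c₁ w₂ c₂
    recover₂ : (a * a + b * b) * (w₂ - c₂) ≡ b * side a b (c₁ , c₂) (w₁ , w₂) + a * axial a b (c₁ , c₂) (w₁ , w₂)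
    recover₂ = solve 6 (λ a b w₁ c₁ w₂ c₂ → (a :* a :+ b :* b) :* (w₂ :- c₂)
                 := b :* (a :* (w₁ :- c₁) :+ b :* (w₂ :- c₂)) :+ a :* ((:- b) :* (w₁ :- c₁) :+ a :* (w₂ :- c₂)))
               refl a b w₁ c₁ w₂ c₂

  side-centre : ∀ a b c → side a b c c ≡ 0ℝ
  side-centre a b (c₁ , c₂) =
    solve 4 (λ a b c₁ c₂ → a :* (c₁ :- c₁) :+ b :* (c₂ :- c₂) := numeral 0) refl a b c₁ c₂

  axial-centre : ∀ a b c → axial a b c c ≡ 0ℝ
  axial-centre a b (c₁ , c₂) =
    solve 4 (λ a b c₁ c₂ → (:- b) :* (c₁ :- c₁) :+ a :* (c₂ :- c₂) := numeral 0) refl a b c₁ c₂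

  _≟ₚ_ : (x y : Point) → Dec (x ≡ y)
  _≟ₚ_ = ≡-dec _≟_ _≟_

  side-negated : ∀ a b c y → side (- a) (- b) c y ≡ - side a b c y
  side-negated a b (c₁ , c₂) (y₁ , y₂) =
    solve 6 (λ a b c₁ c₂ y₁ y₂ → (:- a) :* (y₁ :- c₁) :+ (:- b) :* (y₂ :- c₂) := :- (a :* (y₁ :- c₁) :+ b :* (y₂ :- c₂)))
            refl a b c₁ c₂ y₁ y₂

  nondegenerate-negated : ∀ {a b} → Nondegenerate a b → Nondegenerate (- a) (- b)
  nondegenerate-negated nd (-a≡0 , -b≡0) = nd (-x≡0⇒x≡0 -a≡0 , -x≡0⇒x≡0 -b≡0)

  ≡⇔≡ : ∀ {m m′ n n′ : ℕ} → m ≡ m′ → n ≡ n′ → (m ≡ n) ⇔ (m′ ≡ n′)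
  ≡⇔≡ refl refl = mk⇔ id id

  module _ (l : Line) (c : Point) (c∈l : OnLine l c) where

    lval-γ≡side : ∀ y → lval l y - γ l ≡ side (α l) (β l) c y
    lval-γ≡side y = begin
      lval l y - γ l      ≡⟨ cong (λ g → lval l y - g) (sym c∈l) ⟩
      lval l y - lval l c ≡⟨ solve 6 (λ a b y₁ y₂ c₁ c₂ → (a :* y₁ :+ b :* y₂) :- (a :* c₁ :+ b :* c₂)
                                                          := a :* (y₁ :- c₁) :+ b :* (y₂ :- c₂))
                                     refl (α l) (β l) (proj₁ y) (proj₂ y) (proj₁ c) (proj₂ c) ⟩
      side (α l) (β l) c y ∎
      where open ≡-Reasoning

    aboveᵇ≡posᵇ-side : ∀ y → aboveᵇ l y ≡ posᵇ (side (α l) (β l) c y)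
    aboveᵇ≡posᵇ-side y =
      <ᵇ-cong (subst (0ℝ <_) (lval-γ≡side y) ∘ x<y⇒0<y-x) (0<y-x⇒x<y ∘ subst (0ℝ <_) (sym (lval-γ≡side y)))

    belowᵇ≡negᵇ-side : ∀ y → belowᵇ l y ≡ negᵇ (side (α l) (β l) c y)
    belowᵇ≡negᵇ-side y =
      <ᵇ-cong (subst (_< 0ℝ) (lval-γ≡side y) ∘ x<y⇒x-y<0) (x-y<0⇒x<y ∘ subst (_< 0ℝ) (sym (lval-γ≡side y)))

    onLineᵇ≡zeroᵇ-side : ∀ y → onLineᵇ l y ≡ zeroᵇ (side (α l) (β l) c y)
    onLineᵇ≡zeroᵇ-side y =
      ≡ᵇ-cong (λ y∈l → trans (sym (lval-γ≡side y)) (trans (cong (_- γ l) y∈l) (-‿inverseʳ (γ l))))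
              (λ s≡0 → x-y≡0⇒x≡y (trans (lval-γ≡side y) s≡0))

    good⇔ : ∀ S → Good S l ⇔ (above (α l) (β l) c S ≡ below (α l) (β l) c S)
    good⇔ S = ≡⇔≡ (count-cong S (λ {y} _ → aboveᵇ≡posᵇ-side y)) (count-cong S (λ {y} _ → belowᵇ≡negᵇ-side y))

    evenBalanced⇔ : ∀ S → EvenBalanced S l c ⇔ (ray⁺ (α l) (β l) c S ≡ ray⁻ (α l) (β l) c S)
    evenBalanced⇔ S = ≡⇔≡ (count-cong S (λ {y} _ → cong (_∧ posᵇ (axial (α l) (β l) c y)) (onLineᵇ≡zeroᵇ-side y)))
                          (count-cong S (λ {y} _ → cong (_∧ negᵇ (axial (α l) (β l) c y)) (onLineᵇ≡zeroᵇ-side y)))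

  cond-i⇔halving : ∀ S c → Cond-i S c ⇔ Halving S c
  cond-i⇔halving S c = mk⇔
    (λ cond-i a b nd → Equivalence.to (good⇔ (lineThrough a b c nd) c refl S) (cond-i (lineThrough a b c nd) refl))
    (λ halving l c∈l → Equivalence.from (good⇔ l c c∈l S) (halving (α l) (β l) (nondeg l)))

  cond-iii⇔rayBalanced : ∀ S c → Cond-iii S c ⇔ RayBalanced S c
  cond-iii⇔rayBalanced S c = mk⇔
    (λ cond-iii a b nd → Equivalence.to (evenBalanced⇔ (lineThrough a b c nd) c refl S) (cond-iii (lineThrough a b c nd) refl))
    (λ balanced l c∈l → Equivalence.from (evenBalanced⇔ l c c∈l S) (balanced (α l) (β l) (nondeg l)))

  -- Generic directions and slightly turned lines

  Generic : ℝ → ℝ → List Point → Set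
  Generic a b T = ∀ {y z} → y ∈ T → z ∈ T → side a b z y ≡ 0ℝ → y ≡ z

  GenericHalving : List Point → Point → Set
  GenericHalving S c = ∀ a b → Nondegenerate a b → Generic a b S → above a b c S ≡ below a b c S

  -- (a, b) turned by the angle arctan t and scaled by √(1 + t²)
  turn₁ turn₂ : ℝ → ℝ → ℝ → ℝ
  turn₁ t a b = a + t * (- b)
  turn₂ t a b = b + t * a

  side-turn : ∀ t a b z y → side (turn₁ t a b) (turn₂ t a b) z y ≡ side a b z y + t * axial a b z y
  side-turn t a b (z₁ , z₂) (y₁ , y₂) =
    solve 7 (λ a b t z₁ z₂ y₁ y₂ → (a :+ t :* (:- b)) :* (y₁ :- z₁) :+ (b :+ t :* a) :* (y₂ :- z₂)
                                  := (a :* (y₁ :- z₁) :+ b :* (y₂ :- z₂)) :+ t :* ((:- b) :* (y₁ :- z₁) :+ a :* (y₂ :- z₂)))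
            refl a b t z₁ z₂ y₁ y₂

  turn-nondegenerate : ∀ t {a b} → Nondegenerate a b → Nondegenerate (turn₁ t a b) (turn₂ t a b)
  turn-nondegenerate t {a} {b} nd (turn₁≡0 , turn₂≡0) = nd (a≡0 , b≡0)
    where
    open ≡-Reasoning
    b≡0 : b ≡ 0ℝ
    b≡0 = *-cancelˡ-≡0 (>⇒≢ (0<x+y 0<1 (0≤x*x t))) (begin
      (1ℝ + t * t) * b              ≡⟨ solve 3 (λ a b t → (numeral 1 :+ t :* t) :* b := (b :+ t :* a) :- t :* (a :+ t :* (:- b)))
                                              refl a b t ⟩
      turn₂ t a b - t * turn₁ t a b ≡⟨ cong₂ (λ u v → u - t * v) turn₂≡0 turn₁≡0 ⟩
      0ℝ - t * 0ℝ                   ≡⟨ solve 1 (λ t → numeral 0 :- t :* numeral 0 := numeral 0) refl t ⟩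
      0ℝ                            ∎)
    a≡0 : a ≡ 0ℝ
    a≡0 = begin
      a           ≡⟨ solve 2 (λ a t → a := a :+ t :* (:- numeral 0)) refl a t ⟩
      a + t * (- 0ℝ) ≡⟨ cong (λ u → a + t * (- u)) (sym b≡0) ⟩
      turn₁ t a b ≡⟨ turn₁≡0 ⟩
      0ℝ          ∎

  module SlightTurn (T : List Point) {a b : ℝ} (nd : Nondegenerate a b) where

    coordinates : Point → Point → ℝ × ℝ
    coordinates z y = side a b z y , axial a b z y

    open SmallPerturbation (small-perturbation (cartesianProductWith coordinates T T)) public

    sign-kept : ∀ {t y z} → y ∈ T → z ∈ T → t ≡ ε ⊎ t ≡ - ε → side a b z y ≢ 0ℝ →
                SameSign (side a b z y) (side a b z y + t * axial a b z y)
    sign-kept y∈T z∈T t≡±ε s≢0 = keeps-sign (∈-cartesianProductWith⁺ coordinates z∈T y∈T) s≢0 t≡±ε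

    ±ε≢0 : ∀ {t} → t ≡ ε ⊎ t ≡ - ε → t ≢ 0ℝ
    ±ε≢0 (inj₁ refl) = >⇒≢ 0<ε
    ±ε≢0 (inj₂ refl) = <⇒≢ (0<x⇒-x<0 0<ε)

    generic : ∀ {t} → t ≡ ε ⊎ t ≡ - ε → Generic (turn₁ t a b) (turn₂ t a b) T
    generic {t} t≡±ε {y} {z} y∈T z∈T s′≡0 with side a b z y ≟ 0ℝ
    ... | no s≢0 = ⊥-elim (sameSign-≢0 s≢0 (sign-kept y∈T z∈T t≡±ε s≢0) (trans (sym (side-turn t a b z y)) s′≡0))
    ... | yes s≡0 = side≡0∧axial≡0⇒≡ nd s≡0 (*-cancelˡ-≡0 (±ε≢0 t≡±ε) (begin
          t * axial a b z y                  ≡⟨ sym (+-identityˡ _) ⟩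
          0ℝ + t * axial a b z y             ≡⟨ cong (_+ t * axial a b z y) (sym s≡0) ⟩
          side a b z y + t * axial a b z y   ≡⟨ sym (side-turn t a b z y) ⟩
          side (turn₁ t a b) (turn₂ t a b) z y ≡⟨ s′≡0 ⟩
          0ℝ                                 ∎))
      where open ≡-Reasoning

    above-turned : ∀ {t c} → c ∈ T → t ≡ ε ⊎ t ≡ - ε →
                   above (turn₁ t a b) (turn₂ t a b) c T
                   ≡ above a b c T ℕ.+ count (λ y → zeroᵇ (side a b c y) ∧ posᵇ (t * axial a b c y)) T
    above-turned {t} {c} c∈T t≡±ε = trans
      (count-cong T (λ {y} y∈T → trans (cong posᵇ (side-turn t a b c y)) (posᵇ-perturb (sign-kept y∈T c∈T t≡±ε))))
      (count-∨ T (λ _ → refl) (λ {y} _ pos → cong (_∧ posᵇ (t * axial a b c y)) (posᵇ⇒zeroᵇ≡false pos)))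

    below-turned : ∀ {t c} → c ∈ T → t ≡ ε ⊎ t ≡ - ε →
                   below (turn₁ t a b) (turn₂ t a b) c T
                   ≡ below a b c T ℕ.+ count (λ y → zeroᵇ (side a b c y) ∧ negᵇ (t * axial a b c y)) T
    below-turned {t} {c} c∈T t≡±ε = trans
      (count-cong T (λ {y} y∈T → trans (cong negᵇ (side-turn t a b c y)) (negᵇ-perturb (sign-kept y∈T c∈T t≡±ε))))
      (count-∨ T (λ _ → refl) (λ {y} _ neg → cong (_∧ negᵇ (t * axial a b c y)) (negᵇ⇒zeroᵇ≡false neg)))

  genericHalving⇒rayBalanced : ∀ {S c} → c ∈ S → GenericHalving S c → RayBalanced S c
  genericHalving⇒rayBalanced {S} {c} c∈S halving a b nd =
    +-cross-cancel (above a b c S) (below a b c S) (ray⁺ a b c S) (ray⁻ a b c S)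
      (balanced-after (inj₁ refl) (λ _ → posᵇ-*-pos 0<ε) (λ _ → negᵇ-*-pos 0<ε))
      (balanced-after (inj₂ refl) (λ _ → posᵇ-*-neg 0<ε) (λ _ → negᵇ-*-neg 0<ε))
    where
    open SlightTurn S nd
    -- turning slightly by ±ε moves the points of one ray of the line to each side
    balanced-after : ∀ {t} → t ≡ ε ⊎ t ≡ - ε → {σ⁺ σ⁻ : ℝ → Bool} →
                     (∀ q → posᵇ (t * q) ≡ σ⁺ q) → (∀ q → negᵇ (t * q) ≡ σ⁻ q) →
                     above a b c S ℕ.+ count (λ y → zeroᵇ (side a b c y) ∧ σ⁺ (axial a b c y)) S
                     ≡ below a b c S ℕ.+ count (λ y → zeroᵇ (side a b c y) ∧ σ⁻ (axial a b c y)) S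
    balanced-after {t} t≡±ε {σ⁺} {σ⁻} to⁺ to⁻ = begin
      above a b c S ℕ.+ count (λ y → zeroᵇ (side a b c y) ∧ σ⁺ (axial a b c y)) S
        ≡⟨ cong (above a b c S ℕ.+_) (count-cong S (λ {y} _ → cong (zeroᵇ (side a b c y) ∧_) (sym (to⁺ (axial a b c y))))) ⟩
      above a b c S ℕ.+ count (λ y → zeroᵇ (side a b c y) ∧ posᵇ (t * axial a b c y)) S
        ≡⟨ above-turned c∈S t≡±ε ⟨
      above (turn₁ t a b) (turn₂ t a b) c S
        ≡⟨ halving _ _ (turn-nondegenerate t nd) (generic t≡±ε) ⟩
      below (turn₁ t a b) (turn₂ t a b) c S
        ≡⟨ below-turned c∈S t≡±ε ⟩
      below a b c S ℕ.+ count (λ y → zeroᵇ (side a b c y) ∧ negᵇ (t * axial a b c y)) S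
        ≡⟨ cong (below a b c S ℕ.+_) (count-cong S (λ {y} _ → cong (zeroᵇ (side a b c y) ∧_) (to⁻ (axial a b c y)))) ⟩
      below a b c S ℕ.+ count (λ y → zeroᵇ (side a b c y) ∧ σ⁻ (axial a b c y)) S ∎
      where open ≡-Reasoning

  ∃-generic : ∀ T → ∃[ a ] ∃[ b ] (Nondegenerate a b × Generic a b T)
  ∃-generic T = turn₁ ε 1ℝ 0ℝ , turn₂ ε 1ℝ 0ℝ , turn-nondegenerate ε nd , generic (inj₁ refl)
    where
    nd : Nondegenerate 1ℝ 0ℝ
    nd (1≡0 , _) = 0≢1 (sym 1≡0)
    open SlightTurn T nd

  -- Peeling off the lines through c

  halving-∷-centre : ∀ {T c} → Halving T c → Halving (c ∷ T) c
  halving-∷-centre {T} {c} halving a b nd = begin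
    above a b c (c ∷ T) ≡⟨ count-∷-false T (posᵇ-zero (side-centre a b c)) ⟩
    above a b c T       ≡⟨ halving a b nd ⟩
    below a b c T       ≡⟨ count-∷-false T (negᵇ-zero (side-centre a b c)) ⟨
    below a b c (c ∷ T) ∎
    where open ≡-Reasoning

  rayBalanced-∷-centre : ∀ {T c} → RayBalanced (c ∷ T) c → RayBalanced T c
  rayBalanced-∷-centre {T} {c} balanced a b nd = begin
    ray⁺ a b c T       ≡⟨ count-∷-false T (not-on-ray posᵇ (posᵇ-zero (axial-centre a b c))) ⟨
    ray⁺ a b c (c ∷ T) ≡⟨ balanced a b nd ⟩
    ray⁻ a b c (c ∷ T) ≡⟨ count-∷-false T (not-on-ray negᵇ (negᵇ-zero (axial-centre a b c))) ⟩
    ray⁻ a b c T       ∎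
    where
    open ≡-Reasoning
    not-on-ray : ∀ σ → σ (axial a b c c) ≡ false → (zeroᵇ (side a b c c) ∧ σ (axial a b c c)) ≡ false
    not-on-ray σ σ≡false = trans (cong (zeroᵇ (side a b c c) ∧_) σ≡false) (∧-zeroʳ _)

  module LineThrough (c y : Point) (y≢c : y ≢ c) where
    -- (n₁, n₂) is normal to y - c, so side n₁ n₂ c describes the line ℓ through c and y
    n₁ n₂ : ℝ
    n₁ = proj₂ y - proj₂ c
    n₂ = - (proj₁ y - proj₁ c)

    nd : Nondegenerate n₁ n₂
    nd (n₁≡0 , n₂≡0) = y≢c (cong₂ _,_ (x-y≡0⇒x≡y (-x≡0⇒x≡0 n₂≡0)) (x-y≡0⇒x≡y n₁≡0))

    onℓ : Point → Bool
    onℓ w = zeroᵇ (side n₁ n₂ c w)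

    y∈ℓ : side n₁ n₂ c y ≡ 0ℝ
    y∈ℓ = solve 2 (λ u₁ u₂ → u₂ :* u₁ :+ (:- u₁) :* u₂ := numeral 0) refl (proj₁ y - proj₁ c) (proj₂ y - proj₂ c)

    N : ℝ
    N = n₁ * n₁ + n₂ * n₂

    0<N : 0ℝ < N
    0<N = sumOfSquares-pos nd

    side-decomposition : ∀ a b w →
      N * side a b c w ≡ axial n₁ n₂ c w * side a b c y + side n₁ n₂ c w * (a * n₁ + b * n₂)
    side-decomposition a b w = solve 6 (λ a b u₁ u₂ v₁ v₂ →
        (u₂ :* u₂ :+ (:- u₁) :* (:- u₁)) :* (a :* v₁ :+ b :* v₂)
        := ((:- (:- u₁)) :* v₁ :+ u₂ :* v₂) :* (a :* u₁ :+ b :* u₂)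
           :+ (u₂ :* v₁ :+ (:- u₁) :* v₂) :* (a :* u₂ :+ b :* (:- u₁)))
      refl a b (proj₁ y - proj₁ c) (proj₂ y - proj₂ c) (proj₁ w - proj₁ c) (proj₂ w - proj₂ c)

    side-on-ℓ : ∀ a b {w} → side n₁ n₂ c w ≡ 0ℝ → N * side a b c w ≡ axial n₁ n₂ c w * side a b c y
    side-on-ℓ a b {w} w∈ℓ = begin
      N * side a b c w                       ≡⟨ side-decomposition a b w ⟩
      X + side n₁ n₂ c w * (a * n₁ + b * n₂) ≡⟨ cong (λ s → X + s * (a * n₁ + b * n₂)) w∈ℓ ⟩
      X + 0ℝ * (a * n₁ + b * n₂)             ≡⟨ solve 2 (λ X K → X :+ numeral 0 :* K := X) refl X (a * n₁ + b * n₂) ⟩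
      X                                      ∎
      where
      open ≡-Reasoning
      X : ℝ
      X = axial n₁ n₂ c w * side a b c y

    ℓ-unique : ∀ {a b w} → Nondegenerate a b → side a b c y ≡ 0ℝ → side a b c w ≡ 0ℝ → side n₁ n₂ c w ≡ 0ℝ
    ℓ-unique {a} {b} {w} nd-ab y∈l w∈l = nondegenerate-cancel nd-ab
      (trans a*side (combination≡0 (proj₂ y - proj₂ c) (- (proj₂ w - proj₂ c)) w∈l y∈l))
      (trans b*side (combination≡0 (proj₁ w - proj₁ c) (- (proj₁ y - proj₁ c)) y∈l w∈l))
      where
      a*side : a * side n₁ n₂ c w ≡ (proj₂ y - proj₂ c) * side a b c w + (- (proj₂ w - proj₂ c)) * side a b c y
      a*side = solve 6 (λ a b u₁ u₂ v₁ v₂ → a :* (u₂ :* v₁ :+ (:- u₁) :* v₂)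
                                             := u₂ :* (a :* v₁ :+ b :* v₂) :+ (:- v₂) :* (a :* u₁ :+ b :* u₂))
                 refl a b (proj₁ y - proj₁ c) (proj₂ y - proj₂ c) (proj₁ w - proj₁ c) (proj₂ w - proj₂ c)
      b*side : b * side n₁ n₂ c w ≡ (proj₁ w - proj₁ c) * side a b c y + (- (proj₁ y - proj₁ c)) * side a b c w
      b*side = solve 6 (λ a b u₁ u₂ v₁ v₂ → b :* (u₂ :* v₁ :+ (:- u₁) :* v₂)
                                             := v₁ :* (a :* u₁ :+ b :* u₂) :+ (:- u₁) :* (a :* v₁ :+ b :* v₂))
                 refl a b (proj₁ y - proj₁ c) (proj₂ y - proj₂ c) (proj₁ w - proj₁ c) (proj₂ w - proj₂ c)

    meets-ℓ-only-at-c : ∀ {a b w} → side a b c y ≢ 0ℝ → side n₁ n₂ c w ≡ 0ℝ → side a b c w ≡ 0ℝ → w ≡ c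
    meets-ℓ-only-at-c {a} {b} {w} y∉l w∈ℓ w∈l = side≡0∧axial≡0⇒≡ nd w∈ℓ (*-cancelˡ-≡0 y∉l (begin
      side a b c y * axial n₁ n₂ c w ≡⟨ *-comm _ _ ⟩
      axial n₁ n₂ c w * side a b c y ≡⟨ side-on-ℓ a b w∈ℓ ⟨
      N * side a b c w               ≡⟨ cong (N *_) w∈l ⟩
      N * 0ℝ                         ≡⟨ zeroʳ N ⟩
      0ℝ                             ∎))
      where open ≡-Reasoning

    off : List Point → List Point
    off = filterᵇ (not ∘ onℓ)

    ∉ℓ : ∀ {w} → not (onℓ w) ≡ true → side n₁ n₂ c w ≢ 0ℝ
    ∉ℓ w∉ℓ w∈ℓ with () ← subst (λ b → not b ≡ true) (≡⇒≡ᵇ w∈ℓ) w∉ℓ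

    length-off : ∀ T → length (off (y ∷ T)) ℕ.≤ length T
    length-off T = subst (λ L → length L ℕ.≤ length T)
                         (sym (Listₚ.filter-reject (T? ∘ not ∘ onℓ) (λ y∉ℓ → ∉ℓ (Equivalence.to T-≡ y∉ℓ) y∈ℓ)))
                         (Listₚ.length-filter (T? ∘ not ∘ onℓ) T)

    -- Removing the points of ℓ empties the rays of ℓ and leaves those of any other line through c
    -- unchanged, since it meets ℓ only at c.
    rayBalanced-off : ∀ {S} → RayBalanced S c → RayBalanced (off S) c
    rayBalanced-off {S} balanced a b nd-ab with side a b c y ≟ 0ℝ
    ... | yes y∈l = trans (ray-off-empty posᵇ) (sym (ray-off-empty negᵇ))
      where
      ray-off-empty : ∀ σ → count (λ w → zeroᵇ (side a b c w) ∧ σ (axial a b c w)) (off S) ≡ 0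
      ray-off-empty σ = trans (count-filterᵇ _ (not ∘ onℓ) S)
        (count-∧-none S (λ {w} _ w∉ℓ →
          cong (_∧ σ (axial a b c w)) (≢⇒≡ᵇ≡false (∉ℓ w∉ℓ ∘ ℓ-unique nd-ab y∈l))))
    ... | no y∉l =
      trans (ray-off-same posᵇ posᵇ-zero) (trans (balanced a b nd-ab) (sym (ray-off-same negᵇ negᵇ-zero)))
      where
      ray-off-same : ∀ σ → (∀ {x} → x ≡ 0ℝ → σ x ≡ false) →
                     count (λ w → zeroᵇ (side a b c w) ∧ σ (axial a b c w)) (off S)
                     ≡ count (λ w → zeroᵇ (side a b c w) ∧ σ (axial a b c w)) S
      ray-off-same σ σ-zero = count-filterᵇ-⊇ S off-ℓ
        where
        axial≡0 : ∀ {w} → side n₁ n₂ c w ≡ 0ℝ → side a b c w ≡ 0ℝ → axial a b c w ≡ 0ℝ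
        axial≡0 w∈ℓ w∈l =
          subst (λ v → axial a b c v ≡ 0ℝ) (sym (meets-ℓ-only-at-c y∉l w∈ℓ w∈l)) (axial-centre a b c)
        off-ℓ : ∀ {w} → w ∈ S → (zeroᵇ (side a b c w) ∧ σ (axial a b c w)) ≡ true → not (onℓ w) ≡ true
        off-ℓ {w} _ w∈l∧σ = cong not (¬-not w∉ℓ)
          where
          w∉ℓ : onℓ w ≢ true
          w∉ℓ w∈ℓ =
            not-¬ (∧-conicalʳ _ _ w∈l∧σ) (σ-zero (axial≡0 (≡ᵇ⇒≡ w∈ℓ) (≡ᵇ⇒≡ (∧-conicalˡ _ _ w∈l∧σ))))

    on-ℓ-balanced : ∀ {S} → RayBalanced S c → ∀ a b →
                    count (λ w → onℓ w ∧ posᵇ (side a b c w)) S ≡ count (λ w → onℓ w ∧ negᵇ (side a b c w)) S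
    on-ℓ-balanced {S} balanced a b = by-sign (<-tri (side a b c y) 0ℝ)
      where
      open ≡-Reasoning
      on-ℓ : ∀ {w} → onℓ w ≡ true → N * side a b c w ≡ axial n₁ n₂ c w * side a b c y
      on-ℓ w∈ℓ = side-on-ℓ a b (≡ᵇ⇒≡ w∈ℓ)
      by-sign : Tri (side a b c y < 0ℝ) (side a b c y ≡ 0ℝ) (0ℝ < side a b c y) →
                count (λ w → onℓ w ∧ posᵇ (side a b c w)) S ≡ count (λ w → onℓ w ∧ negᵇ (side a b c w)) S
      by-sign (tri> _ _ 0<L) = begin
        count (λ w → onℓ w ∧ posᵇ (side a b c w)) S
          ≡⟨ count-∧-cong {q = onℓ} S (λ {w} _ w∈ℓ → proj₁ (sign-transfer⁺ 0<N (on-ℓ {w} w∈ℓ) 0<L)) ⟩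
        ray⁺ n₁ n₂ c S
          ≡⟨ balanced n₁ n₂ nd ⟩
        ray⁻ n₁ n₂ c S
          ≡⟨ count-∧-cong {q = onℓ} S (λ {w} _ w∈ℓ → proj₂ (sign-transfer⁺ 0<N (on-ℓ {w} w∈ℓ) 0<L)) ⟨
        count (λ w → onℓ w ∧ negᵇ (side a b c w)) S ∎
      by-sign (tri< L<0 _ _) = begin
        count (λ w → onℓ w ∧ posᵇ (side a b c w)) S
          ≡⟨ count-∧-cong {q = onℓ} S (λ {w} _ w∈ℓ → proj₁ (sign-transfer⁻ 0<N (on-ℓ {w} w∈ℓ) L<0)) ⟩
        ray⁻ n₁ n₂ c S
          ≡⟨ balanced n₁ n₂ nd ⟨
        ray⁺ n₁ n₂ c S
          ≡⟨ count-∧-cong {q = onℓ} S (λ {w} _ w∈ℓ → proj₂ (sign-transfer⁻ 0<N (on-ℓ {w} w∈ℓ) L<0)) ⟨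
        count (λ w → onℓ w ∧ negᵇ (side a b c w)) S ∎
      by-sign (tri≈ _ L≡0 _) =
        count-∧-cong {q = onℓ} S (λ {w} _ w∈ℓ → neither (sign-transfer⁰ 0<N (on-ℓ {w} w∈ℓ) L≡0))
        where
        neither : ∀ {s} → s ≡ 0ℝ → posᵇ s ≡ negᵇ s
        neither s≡0 = trans (posᵇ-zero s≡0) (sym (negᵇ-zero s≡0))

    halving-from-off : ∀ {S} → RayBalanced S c → Halving (off S) c → Halving S c
    halving-from-off {S} balanced halving-off a b nd-ab = begin
      above a b c S
        ≡⟨ count-split _ onℓ S ⟩
      count (λ w → not (onℓ w) ∧ posᵇ (side a b c w)) S ℕ.+ count (λ w → onℓ w ∧ posᵇ (side a b c w)) S
        ≡⟨ cong₂ ℕ._+_ off-ℓ-balanced (on-ℓ-balanced {S} balanced a b) ⟩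
      count (λ w → not (onℓ w) ∧ negᵇ (side a b c w)) S ℕ.+ count (λ w → onℓ w ∧ negᵇ (side a b c w)) S
        ≡⟨ count-split _ onℓ S ⟨
      below a b c S ∎
      where
      open ≡-Reasoning
      off-ℓ-balanced : count (λ w → not (onℓ w) ∧ posᵇ (side a b c w)) S
                       ≡ count (λ w → not (onℓ w) ∧ negᵇ (side a b c w)) S
      off-ℓ-balanced = begin
        count (λ w → not (onℓ w) ∧ posᵇ (side a b c w)) S ≡⟨ count-filterᵇ _ (not ∘ onℓ) S ⟨
        above a b c (off S)                                ≡⟨ halving-off a b nd-ab ⟩
        below a b c (off S)                                ≡⟨ count-filterᵇ _ (not ∘ onℓ) S ⟩
        count (λ w → not (onℓ w) ∧ negᵇ (side a b c w)) S ∎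

  rayBalanced⇒halving : ∀ S c → RayBalanced S c → Halving S c
  rayBalanced⇒halving S c = peel (length S) S ℕ.≤-refl
    where
    -- n is fuel for the strong induction on length S
    peel : ∀ n S → length S ℕ.≤ n → RayBalanced S c → Halving S c
    peel _       []      _            _        a b nd = refl
    peel (suc n) (y ∷ T) (s≤s |T|≤n) balanced with y ≟ₚ c
    ... | yes refl = halving-∷-centre {T} (peel n T |T|≤n (rayBalanced-∷-centre {T} balanced))
    ... | no y≢c   = halving-from-off {y ∷ T} balanced
                       (peel n (off (y ∷ T)) (ℕ.≤-trans (length-off T) |T|≤n) (rayBalanced-off {y ∷ T} balanced))
      where open LineThrough c y y≢c

  genericHalving⇒halving : ∀ {S c} → c ∈ S → GenericHalving S c → Halving S c
  genericHalving⇒halving {S} {c} c∈S = rayBalanced⇒halving S c ∘ genericHalving⇒rayBalanced c∈S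

  halving⇒rayBalanced : ∀ {S c} → c ∈ S → Halving S c → RayBalanced S c
  halving⇒rayBalanced c∈S halving = genericHalving⇒rayBalanced c∈S (λ a b nd _ → halving a b nd)

  -- Perfect lines and medians

  parallel-good-lines : ∀ S (l : Line) γ′ → let l′ = line (α l) (β l) γ′ (nondeg l) in
    Good S l → Good S l′ → γ l < γ′ → ∀ {w w′} → w ∈ S → OnLine l w → w′ ∈ S → OnLine l′ w′ → ⊥
  parallel-good-lines S l γ′ good good′ γ<γ′ w∈S w∈l w′∈S w′∈l′ =
    ℕ.<-irrefl refl (begin-strict
      count (aboveᵇ l′) S <⟨ count-mono-< (λ _ → <⇒<ᵇ ∘ <-trans γ<γ′ ∘ <ᵇ⇒<) w′∈S
                               (<⇒<ᵇ (subst (γ l <_) (sym w′∈l′) γ<γ′))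
                               (≮⇒<ᵇ≡false (<-irrefl _ ∘ subst (γ′ <_) w′∈l′)) ⟩
      count (aboveᵇ l) S  ≡⟨ good ⟩
      count (belowᵇ l) S  <⟨ count-mono-< (λ _ → <⇒<ᵇ ∘ (λ below → <-trans below γ<γ′) ∘ <ᵇ⇒<) w∈S
                               (<⇒<ᵇ (subst (_< γ′) (sym w∈l) γ<γ′))
                               (≮⇒<ᵇ≡false (<-irrefl _ ∘ subst (_< γ l) w∈l)) ⟩
      count (belowᵇ l′) S ≡⟨ good′ ⟨
      count (aboveᵇ l′) S ∎)
    where
    open ℕ.≤-Reasoning
    l′ : Line
    l′ = line (α l) (β l) γ′ (nondeg l)

  cond-i⇒cond-ii : ∀ {S x} → x ∈ S → Cond-i S x → Cond-ii S x
  cond-i⇒cond-ii {S} {x} x∈S cond-i l (good , one-on-l) = compare (<-tri (lval l x) (γ l))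
    where
    l′ : Line
    l′ = line (α l) (β l) (lval l x) (nondeg l)
    good′ : Good S l′
    good′ = cond-i l′ refl
    point-on-l : ∃[ y ] (y ∈ S × onLineᵇ l y ≡ true)
    point-on-l = count-witness (ℕ.≤-reflexive (sym one-on-l))
    compare : Tri (lval l x < γ l) (lval l x ≡ γ l) (γ l < lval l x) → OnLine l x
    compare (tri≈ _ x∈l _) = x∈l
    compare (tri< x<γ _ _) = let _ , y∈S , y∈l = point-on-l in
      ⊥-elim (parallel-good-lines S l′ (γ l) good′ good x<γ x∈S refl y∈S (≡ᵇ⇒≡ y∈l))
    compare (tri> _ _ γ<x) = let _ , y∈S , y∈l = point-on-l in
      ⊥-elim (parallel-good-lines S l (lval l x) good good′ γ<x y∈S (≡ᵇ⇒≡ y∈l) x∈S refl)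

  rank : (Point → ℝ) → List Point → Point → ℕ
  rank v S y = count (λ z → v z <ᵇ v y) S

  InjectiveOn : (Point → ℝ) → List Point → Set
  InjectiveOn v S = ∀ {y z} → y ∈ S → z ∈ S → v y ≡ v z → y ≡ z

  rank-mono : ∀ v S {y z} → v y < v z → rank v S y ℕ.≤ rank v S z
  rank-mono v S y<z = count-mono S (λ _ → <⇒<ᵇ ∘ (λ w<y → <-trans w<y y<z) ∘ <ᵇ⇒<)

  rank-mono-< : ∀ v {S y z} → y ∈ S → v y < v z → rank v S y ℕ.< rank v S z
  rank-mono-< v y∈S y<z =
    count-mono-< (λ _ → <⇒<ᵇ ∘ (λ w<y → <-trans w<y y<z) ∘ <ᵇ⇒<) y∈S (<⇒<ᵇ y<z) (≮⇒<ᵇ≡false (<-irrefl _))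

  rank-surjective : ∀ v S → Unique S → InjectiveOn v S → ∀ {k} → k ℕ.< length S →
                    ∃[ y ] (y ∈ S × rank v S y ≡ k)
  rank-surjective v (z ∷ T) (z∉T ∷ unique) injective k<|S| = by-cases (ℕ.<-cmp _ (rank v T z)) k<|S|
    where
    r : ℕ
    r = rank v T z
    injective′ : InjectiveOn v T
    injective′ y∈T z∈T = injective (there y∈T) (there z∈T)
    -- ranks below r are those in T, ranks above r are those in T shifted by one
    by-cases : ∀ {k} → Tri (k ℕ.< r) (k ≡ r) (r ℕ.< k) → k ℕ.< suc (length T) →
               ∃[ y ] (y ∈ z ∷ T × rank v (z ∷ T) y ≡ k)
    by-cases (tri≈ _ refl _) _ = z , here refl , count-∷-false T (≮⇒<ᵇ≡false (<-irrefl _))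
    by-cases (tri< k<r _ _) _ =
      let y , y∈T , rank≡k = rank-surjective v T unique injective′ (ℕ.<-≤-trans k<r (count-≤-length _ T))
      in y , there y∈T , trans (count-∷-false T (≮⇒<ᵇ≡false (z≮y k<r rank≡k))) rank≡k
      where
      z≮y : ∀ {k y} → k ℕ.< r → rank v T y ≡ k → ¬ (v z < v y)
      z≮y k<r rank≡k z<y = ℕ.<⇒≱ k<r (subst (r ℕ.≤_) rank≡k (rank-mono v T z<y))
    by-cases {suc k} (tri> _ _ r<1+k) (s≤s k<|T|) =
      let y , y∈T , rank≡k = rank-surjective v T unique injective′ k<|T|
      in y , there y∈T , trans (count-∷-true T (<⇒<ᵇ (z<y y∈T rank≡k))) (cong suc rank≡k)
      where
      z<y : ∀ {y} → y ∈ T → rank v T y ≡ k → v z < v y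
      z<y {y} y∈T rank≡k with <-tri (v z) (v y)
      ... | tri< z<y _ _ = z<y
      ... | tri≈ _ z≡y _ = ⊥-elim (All.lookup z∉T y∈T (injective (here refl) (there y∈T) z≡y))
      ... | tri> _ _ y<z = ⊥-elim (ℕ.<⇒≱ (subst (ℕ._< r) rank≡k (rank-mono-< v y∈T y<z)) (ℕ.≤-pred r<1+k))

  generic⇒on≡1 : ∀ {S a b y} → Unique S → Generic a b S → y ∈ S → on a b y S ≡ 1
  generic⇒on≡1 {a = a} {b} {y} unique generic y∈S =
    count≡1 unique y∈S (≡⇒≡ᵇ (side-centre a b y)) (λ z∈S z-on → generic z∈S y∈S (≡ᵇ⇒≡ z-on))

  ∃-median : ∀ {S a b} → Unique S → length S % 2 ≡ 1 → Generic a b S →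
             ∃[ y ] (y ∈ S × above a b y S ≡ below a b y S)
  ∃-median {S} {a} {b} unique odd generic =
    let y , y∈S , rank≡h = rank-surjective v S unique injective h<|S| in y , y∈S , median y∈S rank≡h
    where
    v : Point → ℝ
    v (z₁ , z₂) = a * z₁ + b * z₂
    side≡v-v : ∀ y z → side a b y z ≡ v z - v y
    side≡v-v (y₁ , y₂) (z₁ , z₂) =
      solve 6 (λ a b y₁ y₂ z₁ z₂ → a :* (z₁ :- y₁) :+ b :* (z₂ :- y₂) := (a :* z₁ :+ b :* z₂) :- (a :* y₁ :+ b :* y₂))
              refl a b y₁ y₂ z₁ z₂
    injective : InjectiveOn v S
    injective {y} {z} y∈S z∈S vy≡vz =
      generic y∈S z∈S (trans (side≡v-v z y) (trans (cong (_- v z) vy≡vz) (-‿inverseʳ (v z))))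
    h : ℕ
    h = length S / 2
    |S|≡1+2h : length S ≡ suc (h ℕ.* 2)
    |S|≡1+2h = trans (m≡m%n+[m/n]*n (length S) 2) (cong (ℕ._+ h ℕ.* 2) odd)
    h<|S| : h ℕ.< length S
    h<|S| = subst (h ℕ.<_) (sym |S|≡1+2h) (s≤s (ℕ.m≤m*n h 2))
    median : ∀ {y} → y ∈ S → rank v S y ≡ h → above a b y S ≡ below a b y S
    median {y} y∈S rank≡h = trans (half-of-odd above+[h+1]≡1+2h) (sym below≡h)
      where
      open ≡-Reasoning
      below≡h : below a b y S ≡ h
      below≡h = trans (count-cong S (λ {z} _ → <ᵇ-cong (x-y<0⇒x<y ∘ subst (_< 0ℝ) (side≡v-v y z))
                                                       (subst (_< 0ℝ) (sym (side≡v-v y z)) ∘ x<y⇒x-y<0)))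
                      rank≡h
      above+[h+1]≡1+2h : above a b y S ℕ.+ (h ℕ.+ 1) ≡ suc (h ℕ.* 2)
      above+[h+1]≡1+2h = begin
        above a b y S ℕ.+ (h ℕ.+ 1)
          ≡⟨ cong₂ (λ m n → above a b y S ℕ.+ (m ℕ.+ n)) below≡h (generic⇒on≡1 unique generic y∈S) ⟨
        above a b y S ℕ.+ (below a b y S ℕ.+ on a b y S)
          ≡⟨ above+below+on a b y S ⟩
        length S
          ≡⟨ |S|≡1+2h ⟩
        suc (h ℕ.* 2) ∎

  cond-ii⇒genericHalving : ∀ S x → Unique S → length S % 2 ≡ 1 → Cond-ii S x → GenericHalving S x
  cond-ii⇒genericHalving S x unique odd cond-ii a b nd generic =
    let y , y∈S , median = ∃-median unique odd generic in halving-at-median y∈S median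
    where
    halving-at-median : ∀ {y} → y ∈ S → above a b y S ≡ below a b y S → above a b x S ≡ below a b x S
    halving-at-median {y} y∈S median = Equivalence.to (good⇔ l x (cond-ii l (good , one-on-l)) S) good
      where
      l : Line
      l = lineThrough a b y nd
      good : Good S l
      good = Equivalence.from (good⇔ l y refl S) median
      one-on-l : count (onLineᵇ l) S ≡ 1
      one-on-l = trans (count-cong S (λ {z} _ → onLineᵇ≡zeroᵇ-side l y refl z)) (generic⇒on≡1 unique generic y∈S)

  -- The game

  V-A+V-B≤length : ∀ S a b → V-A S a b ℕ.+ V-B S a b ℕ.≤ length S
  V-A+V-B≤length S a b = subst (ℕ._≤ length S) (count-∨ S (λ _ → refl) disjoint) (count-≤-length _ S)
    where
    disjoint : ∀ {y} → y ∈ S → (dist² a y <ᵇ dist² b y) ≡ true → (dist² b y <ᵇ dist² a y) ≡ false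
    disjoint _ a-closer = ≮⇒<ᵇ≡false (<-asym (<ᵇ⇒< a-closer))

  dist²-gain : ∀ c b y → let d₁ = proj₁ b - proj₁ c ; d₂ = proj₂ b - proj₂ c in
               dist² c y - dist² b y ≡ (side d₁ d₂ c y + side d₁ d₂ c y) - (d₁ * d₁ + d₂ * d₂)
  dist²-gain (c₁ , c₂) (b₁ , b₂) (y₁ , y₂) = solve 6 (λ c₁ c₂ b₁ b₂ y₁ y₂ →
      ((c₁ :- y₁) :* (c₁ :- y₁) :+ (c₂ :- y₂) :* (c₂ :- y₂)) :- ((b₁ :- y₁) :* (b₁ :- y₁) :+ (b₂ :- y₂) :* (b₂ :- y₂))
      := (((b₁ :- c₁) :* (y₁ :- c₁) :+ (b₂ :- c₂) :* (y₂ :- c₂)) :+ ((b₁ :- c₁) :* (y₁ :- c₁) :+ (b₂ :- c₂) :* (y₂ :- c₂)))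
         :- ((b₁ :- c₁) :* (b₁ :- c₁) :+ (b₂ :- c₂) :* (b₂ :- c₂)))
    refl c₁ c₂ b₁ b₂ y₁ y₂

  halving⇒winning : ∀ S c → Halving S c → WinningPoint S c
  halving⇒winning S c halving b with b ≟ₚ c
  ... | yes refl = subst (ℕ._≤ V-A S c c) (sym (count-none S (λ _ → ≮⇒<ᵇ≡false (<-irrefl _)))) z≤n
  ... | no b≢c = begin
    V-B S c b       ≤⟨ count-mono S (λ {y} _ → <⇒<ᵇ ∘ rival-closer⇒above y ∘ <ᵇ⇒<) ⟩
    above d₁ d₂ c S ≡⟨ halving d₁ d₂ nd ⟩
    below d₁ d₂ c S ≤⟨ count-mono S (λ {y} _ → <⇒<ᵇ ∘ below⇒alice-closer y ∘ <ᵇ⇒<) ⟩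
    V-A S c b       ∎
    where
    open ℕ.≤-Reasoning
    d₁ d₂ : ℝ
    d₁ = proj₁ b - proj₁ c
    d₂ = proj₂ b - proj₂ c
    nd : Nondegenerate d₁ d₂
    nd (d₁≡0 , d₂≡0) = b≢c (cong₂ _,_ (x-y≡0⇒x≡y d₁≡0) (x-y≡0⇒x≡y d₂≡0))
    0≤|d|² : 0ℝ ≤ d₁ * d₁ + d₂ * d₂
    0≤|d|² = <⇒≤ (sumOfSquares-pos nd)
    rival-closer⇒above : ∀ y → dist² b y < dist² c y → 0ℝ < side d₁ d₂ c y
    rival-closer⇒above y closer =
      0<[x+x]-d⇒0<x 0≤|d|² (subst (0ℝ <_) (dist²-gain c b y) (x<y⇒0<y-x closer))
    below⇒alice-closer : ∀ y → side d₁ d₂ c y < 0ℝ → dist² c y < dist² b y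
    below⇒alice-closer y below =
      x-y<0⇒x<y (subst (_< 0ℝ) (sym (dist²-gain c b y)) (x<0⇒[x+x]-d<0 0≤|d|² below))

  module NearbyRival (S : List Point) (c : Point) {a b : ℝ} (nd : Nondegenerate a b) where
    N : ℝ
    N = a * a + b * b

    twice-side : Point → ℝ
    twice-side y = side a b c y + side a b c y

    open SmallPerturbation (small-perturbation (map (λ y → twice-side y , - N) S)) public

    rival : Point
    rival = (proj₁ c + ε * a , proj₂ c + ε * b)

    gain : ∀ y → dist² c y - dist² rival y ≡ ε * (twice-side y + ε * (- N))
    gain y = solve 7 (λ c₁ c₂ y₁ y₂ a b e →
        ((c₁ :- y₁) :* (c₁ :- y₁) :+ (c₂ :- y₂) :* (c₂ :- y₂))
        :- (((c₁ :+ e :* a) :- y₁) :* ((c₁ :+ e :* a) :- y₁) :+ ((c₂ :+ e :* b) :- y₂) :* ((c₂ :+ e :* b) :- y₂))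
        := e :* (((a :* (y₁ :- c₁) :+ b :* (y₂ :- c₂)) :+ (a :* (y₁ :- c₁) :+ b :* (y₂ :- c₂))) :+ e :* (:- (a :* a :+ b :* b))))
      refl (proj₁ c) (proj₂ c) (proj₁ y) (proj₂ y) a b ε

    rival-closer : ∀ {y} → y ∈ S → 0ℝ < side a b c y → dist² rival y < dist² c y
    rival-closer {y} y∈S 0<s = 0<y-x⇒x<y (subst (0ℝ <_) (sym (gain y)) (*-pos 0<ε (proj₁ kept 0<2s)))
      where
      0<2s : 0ℝ < twice-side y
      0<2s = subst (_< twice-side y) (+-identityˡ 0ℝ) (+-mono-< 0<s 0<s)
      kept : SameSign (twice-side y) (twice-side y + ε * (- N))
      kept = keeps-sign (∈-map⁺ _ y∈S) (>⇒≢ 0<2s) (inj₁ refl)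

    above≤V-B : above a b c S ℕ.≤ V-B S c rival
    above≤V-B = count-mono S (λ y∈S → <⇒<ᵇ ∘ rival-closer y∈S ∘ <ᵇ⇒<)

  winning⇒above-half : ∀ {S c} → WinningPoint S c → ∀ {a b} → Nondegenerate a b →
                       above a b c S ℕ.+ above a b c S ℕ.≤ length S
  winning⇒above-half {S} {c} winning nd = begin
    above _ _ c S ℕ.+ above _ _ c S   ≤⟨ ℕ.+-mono-≤ above≤V-B above≤V-B ⟩
    V-B S c rival ℕ.+ V-B S c rival   ≤⟨ ℕ.+-monoˡ-≤ (V-B S c rival) (winning rival) ⟩
    V-A S c rival ℕ.+ V-B S c rival   ≤⟨ V-A+V-B≤length S c rival ⟩
    length S                          ∎
    where
    open ℕ.≤-Reasoning
    open NearbyRival S c nd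

  winning⇒below-half : ∀ {S c} → WinningPoint S c → ∀ {a b} → Nondegenerate a b →
                       below a b c S ℕ.+ below a b c S ℕ.≤ length S
  winning⇒below-half {S} {c} winning {a} {b} nd =
    subst (λ k → k ℕ.+ k ℕ.≤ length S)
          (count-cong S (λ {y} _ → trans (cong posᵇ (side-negated a b c y)) (posᵇ-neg _)))
          (winning⇒above-half {S} {c} winning (nondegenerate-negated nd))

  winning⇒balanced : ∀ {S c} → Unique S → length S % 2 ≡ 1 → WinningPoint S c →
                     ∀ {a b} → Nondegenerate a b → Generic a b (c ∷ S) →
                     on a b c S ≡ 1 × above a b c S ≡ below a b c S
  winning⇒balanced {S} {c} unique odd winning {a} {b} nd generic =
    balanced-by-parity P≤N+z N≤P+z z≤1 (subst (λ n → n % 2 ≡ 1) (sym total) odd)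
    where
    P N z : ℕ
    P = above a b c S
    N = below a b c S
    z = on a b c S
    total : P ℕ.+ (N ℕ.+ z) ≡ length S
    total = above+below+on a b c S
    P≤N+z : P ℕ.≤ N ℕ.+ z
    P≤N+z = ℕ.+-cancelˡ-≤ P _ _ (subst (P ℕ.+ P ℕ.≤_) (sym total) (winning⇒above-half {S} {c} winning nd))
    N≤P+z : N ℕ.≤ P ℕ.+ z
    N≤P+z = ℕ.+-cancelˡ-≤ N _ _
              (subst (N ℕ.+ N ℕ.≤_) (trans (sym total) (swap P N z)) (winning⇒below-half {S} {c} winning nd))
      where
      swap : ∀ P N z → P ℕ.+ (N ℕ.+ z) ≡ N ℕ.+ (P ℕ.+ z)
      swap = solve-∀
    z≤1 : z ℕ.≤ 1
    z≤1 = count-≤1 unique (λ y∈S y-on → generic (there y∈S) (here refl) (≡ᵇ⇒≡ y-on))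

  winning⇒∈ : ∀ S c → Unique S → length S % 2 ≡ 1 → WinningPoint S c → c ∈ S
  winning⇒∈ S c unique odd winning =
    let a , b , nd , generic = ∃-generic (c ∷ S)
        on≡1 , _ = winning⇒balanced {S} {c} unique odd winning nd generic
        y , y∈S , y-on = count-witness (ℕ.≤-reflexive (sym on≡1))
    in subst (_∈ S) (generic (there y∈S) (here refl) (≡ᵇ⇒≡ y-on)) y∈S

  winning⇒genericHalving : ∀ S c → Unique S → length S % 2 ≡ 1 → WinningPoint S c → c ∈ S →
                           GenericHalving S c
  winning⇒genericHalving S c unique odd winning c∈S a b nd generic =
    proj₂ (winning⇒balanced {S} {c} unique odd winning nd (λ y∈ z∈ → generic (∈S y∈) (∈S z∈)))
    where
    ∈S : ∀ {y} → y ∈ c ∷ S → y ∈ S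
    ∈S (here refl) = c∈S
    ∈S (there y∈S) = y∈S

  winning⇒halving : ∀ S c → Unique S → length S % 2 ≡ 1 → WinningPoint S c → c ∈ S × Halving S c
  winning⇒halving S c unique odd winning =
    c∈S , genericHalving⇒halving c∈S (winning⇒genericHalving S c unique odd winning c∈S)
    where
    c∈S : c ∈ S
    c∈S = winning⇒∈ S c unique odd winning

theorem4 : (R : RealField) (S : List (Plane.Point R)) → Unique S → length S % 2 ≡ 1 →
    ((x : Plane.Point R) → x ∈ S →
      (Plane.Cond-i R S x ⇔ Plane.Cond-ii R S x) × (Plane.Cond-i R S x ⇔ Plane.Cond-iii R S x))
    × (Plane.AliceWins R S ⇔ (∃[ x ] (x ∈ S × Plane.Cond-i R S x)))
    × ((x : Plane.Point R) → x ∈ S → Plane.Cond-i R S x → Plane.WinningPoint R S x)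
theorem4 R S unique odd = equivalences , alice-wins , λ x _ → halving⇒winning S x ∘ to (cond-i⇔halving S x)
  where
  open Plane R
  open VoronoiGame R
  open Equivalence

  equivalences : (x : Point) → x ∈ S → (Cond-i S x ⇔ Cond-ii S x) × (Cond-i S x ⇔ Cond-iii S x)
  equivalences x x∈S =
      mk⇔ (cond-i⇒cond-ii x∈S)
          (from (cond-i⇔halving S x) ∘ genericHalving⇒halving x∈S ∘ cond-ii⇒genericHalving S x unique odd)
    , mk⇔ (from (cond-iii⇔rayBalanced S x) ∘ halving⇒rayBalanced x∈S ∘ to (cond-i⇔halving S x))
          (from (cond-i⇔halving S x) ∘ rayBalanced⇒halving S x ∘ to (cond-iii⇔rayBalanced S x))

  alice-wins : AliceWins S ⇔ (∃[ x ] (x ∈ S × Cond-i S x))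
  alice-wins = mk⇔
    (λ (c , winning) → let c∈S , halving = winning⇒halving S c unique odd winning
                        in c , c∈S , from (cond-i⇔halving S c) halving)
    (λ (x , _ , cond-i) → x , halving⇒winning S x (to (cond-i⇔halving S x) cond-i))
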